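{- Let $\kappa_1,\kappa_2\in\mathbb Z_{\ge2}$ with $\kappa_1\ge\kappa_2$ and $\lambda=(\kappa_1,\kappa_2,0)$, with $w_0,w_{pq},w_p\in V_\lambda$ as in the context. (a) If $\kappa_1,\kappa_2$ are both even, then $w=w_0$ satisfies $\tau_\lambda(E^{\mathfrak k}_{1,3})w=\tau_\lambda(E^{\mathfrak k}_{2,4})w=0$ and $\tau_\lambda(m_i)w=w$ ($0\le i\le3$). (b) If $\kappa_1,\kappa_2$ are both odd, then $w=E^{\mathfrak p}_{1,2}\otimes w_{12}-E^{\mathfrak p}_{2,3}\otimes w_{23}+E^{\mathfrak p}_{3,4}\otimes w_{34}+E^{\mathfrak p}_{1,4}\otimes w_{14}\in\mathfrak p_{\mathbb C}\otimes V_\lambda$ satisfies $(\mathrm{ad}\otimes\tau_\lambda)(E^{\mathfrak k}_{1,3})w=(\mathrm{ad}\otimes\tau_\lambda)(E^{\mathfrak k}_{2,4})w=0$ and $(\mathrm{Ad}\otimes\tau_\lambda)(m_i)w=w$ ($0\le i\le3$). (c) If $\kappa_1-\kappa_2$ is odd, then $w=w_2+\sqrt{ -1}w_4$ satisfies $\tau_\lambda(E^{\mathfrak k}_{1,3})w=0$, $\tau_\lambda(E^{\mathfrak k}_{2,4})w=\sqrt{ -1}w$, $\tau_\lambda(m_i)w=w$ for $i=0,1$, and $\tau_\lambda(m_i)w=(-1)^{\kappa_1}\overline w$ for $i=2,3$, where $\overline w=w_2-\sqrt{ -1}w_4$.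
   Context: $K=\mathrm O(4)$; $\mathfrak p_{\mathbb C}$ is the complexified space of real symmetric $4\times4$ matrices, with $K$ acting by $\mathrm{Ad}$ and $\mathfrak k$ by $\mathrm{ad}$; actions on $\mathfrak p_{\mathbb C}\otimes V_\lambda$ are diagonal. $E^{\mathfrak k}_{i,j}=E_{i,j}-E_{j,i}$, $E^{\mathfrak p}_{i,j}=E_{i,j}+E_{j,i}$ ($E_{i,j}$ matrix units). $m_0=1_4$, $m_1=\mathrm{diag}(-1,1,1,1)$, $m_2=\mathrm{diag}(1,-1,1,1)$, $m_3=m_1m_2$. $K$-types: $V_{st}=\mathbb C^4$ with basis $\xi_1..\xi_4$, $K$ acting by multiplication, $\xi_{ij}=\xi_i\wedge\xi_j$; $\mathcal R=\mathrm{Sym}(V_{st})\otimes\mathrm{Sym}(\wedge^2V_{st})$, $\mathcal R_{(\lambda_1,\lambda_2)}=\mathrm{Sym}^{\lambda_1-\lambda_2}(V_{st})\otimes\mathrm{Sym}^{\lambda_2}(\wedge^2V_{st})$; $I_{\mathcal R}$ the ideal generated by $\sum_k\xi_k^2$, $\xi_{12}\xi_{34}-\xi_{13}\xi_{24}+\xi_{14}\xi_{23}$, $\sum_k\xi_k\xi_{ik}$, $\sum_k\xi_{ik}\xi_{jk}$ ($i\le j$), $\xi_i\xi_{jk}-\xi_j\xi_{ik}+\xi_k\xi_{ij}$ ($i<j<k$); $q_{\mathcal R}$ the quotient map; $V_\lambda=q_{\mathcal R}(\mathcal R_{(\lambda_1,\lambda_2)})$ with $\tau_\lambda(k)=(\det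 k)^{\lambda_3}\cdot$(induced action), $\tau_\lambda$ also denoting its differential. With $\xi=\xi_1^2+\xi_3^2$: if $\kappa_1-\kappa_2$ is even, $w_0=q_{\mathcal R}(\xi^{(\kappa_1-\kappa_2)/2}\xi_{24}^{\kappa_2})$ and $w_{pq}=q_{\mathcal R}(\xi^{(\kappa_1-\kappa_2)/2}\xi_{pq}\xi_{24}^{\kappa_2-1})$; if $\kappa_1-\kappa_2$ is odd, $w_p=q_{\mathcal R}(\xi^{(\kappa_1-\kappa_2-1)/2}\xi_p\xi_{24}^{\kappa_2})$. -}

module Defs where

open import Data.Nat as ℕ using (ℕ; zero; suc)
open import Data.Integer as ℤ using (+_)
open import Data.Rational as ℚ using (ℚ; 0ℚ; 1ℚ)
open import Data.Fin as Fin using (Fin; zero; suc)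
open import Data.Vec as Vec using (Vec; []; _∷_; lookup; zipWith; replicate; updateAt)
import Data.Vec.Properties as VecP
open import Data.List as List using (List; []; _∷_; _++_; concatMap)
open import Data.Product using (Σ; _×_; _,_)
open import Data.Sum using (inj₁; inj₂)
open import Data.Bool using (if_then_else_)
open import Relation.Nullary.Decidable using (⌊_⌋)
open import Relation.Binary.PropositionalEquality using (_≡_)

-- Scalars: ℚ(√-1) ⊂ ℂ  (all scalars occurring are in ℚ(i); ideal
-- membership is invariant under field extension)

record ℚi : Set where
  constructor _+i_
  field re im : ℚ
open ℚi public

infixl 6 _⊕_
infixl 7 _⊛_
_⊕_ : ℚi → ℚi → ℚi
(a +i b) ⊕ (c +i d) = (a ℚ.+ c) +i (b ℚ.+ d)

_⊛_ : ℚi → ℚi → ℚi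
(a +i b) ⊛ (c +i d) = ((a ℚ.* c) ℚ.- (b ℚ.* d)) +i ((a ℚ.* d) ℚ.+ (b ℚ.* c))

⊝_ : ℚi → ℚi
⊝ (a +i b) = (ℚ.- a) +i (ℚ.- b)

0i 1i √-1 : ℚi
0i = 0ℚ +i 0ℚ
1i = 1ℚ +i 0ℚ
√-1 = 0ℚ +i 1ℚ

ℕ→ℚi : ℕ → ℚi
ℕ→ℚi n = (+ n ℚ./ 1) +i 0ℚ

sgn : ℕ → ℚi
sgn zero = 1i
sgn (suc n) = ⊝ sgn n

-- The polynomial ring ℂ[ξ1..ξ4, ξ12, ξ13, ξ14, ξ23, ξ24, ξ34]
-- (= Sym(V_st) ⊗ Sym(∧²V_st), 10 commuting variables).
-- Variable indices: 0..3 ↦ ξ1..ξ4 ; 4 ↦ ξ12, 5 ↦ ξ13, 6 ↦ ξ14,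
-- 7 ↦ ξ23, 8 ↦ ξ24, 9 ↦ ξ34.

Var : Set
Var = Fin 10

Mono : Set
Mono = Vec ℕ 10

Poly : Set
Poly = List (ℚi × Mono)

coeff : Poly → Mono → ℚi
coeff [] m = 0i
coeff ((c , e) ∷ p) m = if ⌊ VecP.≡-dec ℕ._≟_ e m ⌋ then c ⊕ coeff p m else coeff p m

_≈P_ : Poly → Poly → Set
p ≈P q = (m : Mono) → coeff p m ≡ coeff q m

unitMono : Mono
unitMono = replicate 10 0

const : ℚi → Poly
const c = (c , unitMono) ∷ []

var : Var → Poly
var v = (1i , updateAt unitMono v (λ _ → 1)) ∷ []

0P 1P : Poly
0P = []
1P = const 1i

infixl 6 _+P_ _-P_
infixl 7 _*P_ _·P_
_+P_ : Poly → Poly → Poly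
_+P_ = _++_

_·P_ : ℚi → Poly → Poly
c ·P p = List.map (λ { (d , e) → (c ⊛ d , e) }) p

infix 8 -P_
-P_ : Poly → Poly
-P p = (⊝ 1i) ·P p

_-P_ : Poly → Poly → Poly
p -P q = p +P (-P q)

_*P_ : Poly → Poly → Poly
p *P q = concatMap (λ { (c , e) → List.map (λ { (d , f) → (c ⊛ d , zipWith ℕ._+_ e f) }) q }) p

_^P_ : Poly → ℕ → Poly
p ^P zero = 1P
p ^P suc n = p *P (p ^P n)

sumF : {n : ℕ} → (Fin n → Poly) → Poly
sumF {zero} f = 0P
sumF {suc n} f = f zero +P sumF (λ i → f (suc i))

substP : (Var → Poly) → Poly → Poly
substP s p = List.foldr (λ { (c , e) acc →
  (c ·P prodV e) +P acc }) 0P p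
  where
  prodV : Mono → Poly
  prodV e = List.foldr (λ v acc → (s v ^P lookup e v) *P acc) 1P (List.allFin 10)

∂ : Var → Poly → Poly
∂ v p = concatMap (λ { (c , e) → dterm c e (lookup e v) }) p
  where
  dterm : ℚi → Mono → ℕ → Poly
  dterm c e zero = []
  dterm c e (suc k) = (c ⊛ ℕ→ℚi (suc k) , updateAt e v (λ _ → k)) ∷ []

derivP : (Var → Poly) → Poly → Poly
derivP d p = sumF (λ v → ∂ v p *P d v)

-- Generators of Sym(V_st) and Sym(∧²V_st) in terms of Fin 4 indices
-- (index 0..3 stands for 1..4).

ξ : Fin 4 → Poly
ξ i = var (i Fin.↑ˡ 6)

wv : Fin 6 → Poly
wv w = var (4 Fin.↑ʳ w)

-- ξ_{ij} = ξ_i ∧ ξ_j  (antisymmetric; ξ_{ii} = 0)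
ξ₂ : Fin 4 → Fin 4 → Poly
ξ₂ zero zero = 0P
ξ₂ zero (suc zero) = wv zero
ξ₂ zero (suc (suc zero)) = wv (suc zero)
ξ₂ zero (suc (suc (suc zero))) = wv (suc (suc zero))
ξ₂ (suc zero) zero = -P wv zero
ξ₂ (suc zero) (suc zero) = 0P
ξ₂ (suc zero) (suc (suc zero)) = wv (suc (suc (suc zero)))
ξ₂ (suc zero) (suc (suc (suc zero))) = wv (suc (suc (suc (suc zero))))
ξ₂ (suc (suc zero)) zero = -P wv (suc zero)
ξ₂ (suc (suc zero)) (suc zero) = -P wv (suc (suc (suc zero)))
ξ₂ (suc (suc zero)) (suc (suc zero)) = 0P
ξ₂ (suc (suc zero)) (suc (suc (suc zero))) = wv (suc (suc (suc (suc (suc zero)))))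
ξ₂ (suc (suc (suc zero))) zero = -P wv (suc (suc zero))
ξ₂ (suc (suc (suc zero))) (suc zero) = -P wv (suc (suc (suc (suc zero))))
ξ₂ (suc (suc (suc zero))) (suc (suc zero)) = -P wv (suc (suc (suc (suc (suc zero)))))
ξ₂ (suc (suc (suc zero))) (suc (suc (suc zero))) = 0P

wedgeIdx : Fin 6 → Fin 4 × Fin 4
wedgeIdx zero = (zero , suc zero)
wedgeIdx (suc zero) = (zero , suc (suc zero))
wedgeIdx (suc (suc zero)) = (zero , suc (suc (suc zero)))
wedgeIdx (suc (suc (suc zero))) = (suc zero , suc (suc zero))
wedgeIdx (suc (suc (suc (suc zero)))) = (suc zero , suc (suc (suc zero)))
wedgeIdx (suc (suc (suc (suc (suc zero))))) = (suc (suc zero) , suc (suc (suc zero)))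

gens : List Poly
gens =
  sumF (λ k → ξ k *P ξ k)
  ∷ ((ξ₂ i0 i1 *P ξ₂ i2 i3) -P (ξ₂ i0 i2 *P ξ₂ i1 i3) +P (ξ₂ i0 i3 *P ξ₂ i1 i2))
  ∷ List.map (λ i → sumF (λ k → ξ k *P ξ₂ i k)) (List.allFin 4)
  ++ concatMap (λ i → List.map (λ j → sumF (λ k → ξ₂ i k *P ξ₂ j k))
                                (List.filter (λ j → Fin._≤?_ i j) (List.allFin 4)))
               (List.allFin 4)
  ++ ( triple i0 i1 i2 ∷ triple i0 i1 i3 ∷ triple i0 i2 i3 ∷ triple i1 i2 i3 ∷ [])
  where
  i0 i1 i2 i3 : Fin 4
  i0 = zero
  i1 = suc zero
  i2 = suc (suc zero)
  i3 = suc (suc (suc zero))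
  triple : Fin 4 → Fin 4 → Fin 4 → Poly
  triple i j k = (ξ i *P ξ₂ j k) -P (ξ j *P ξ₂ i k) +P (ξ k *P ξ₂ i j)

combine : List Poly → List Poly → Poly
combine [] _ = 0P
combine (c ∷ cs) [] = 0P
combine (c ∷ cs) (g ∷ gs) = (c *P g) +P combine cs gs

InI : Poly → Set
InI p = Σ (List Poly) (λ cs → p ≈P combine cs gens)

-- equality in V = R / I_R  (q_R(p) = q_R(q))
_≈V_ : Poly → Poly → Set
p ≈V q = InI (p -P q)

Mat : Set
Mat = Fin 4 → Fin 4 → ℚi

δ : Fin 4 → Fin 4 → ℚi
δ i j = if ⌊ i Fin.≟ j ⌋ then 1i else 0i

E : Fin 4 → Fin 4 → Mat
E a b i j = δ i a ⊛ δ j b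

Eᵏ : Fin 4 → Fin 4 → Mat
Eᵏ a b i j = E a b i j ⊕ (⊝ E b a i j)

diag : (Fin 4 → ℚi) → Mat
diag d i j = δ i j ⊛ d i

m : Fin 4 → Mat
m zero = diag (λ _ → 1i)
m (suc zero) = diag (λ { zero → ⊝ 1i ; _ → 1i })
m (suc (suc zero)) = diag (λ { (suc zero) → ⊝ 1i ; _ → 1i })
m (suc (suc (suc zero))) = diag (λ { zero → ⊝ 1i ; (suc zero) → ⊝ 1i ; _ → 1i })

onVst : Mat → Fin 4 → Poly
onVst X c = sumF (λ d → X d c ·P ξ d)

-- induced action on the polynomial generators, group case:
-- ξ_c ↦ kξ_c, ξ_{ij} ↦ kξ_i ∧ kξ_j
grpVar : Mat → Var → Poly
grpVar k v with Fin.splitAt 4 v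
... | inj₁ c = onVst k c
... | inj₂ w with wedgeIdx w
...   | (i , j) = sumF (λ d → sumF (λ e → (k d i ⊛ k e j) ·P ξ₂ d e))

-- Lie algebra case: ξ_c ↦ Xξ_c, ξ_{ij} ↦ Xξ_i ∧ ξ_j + ξ_i ∧ Xξ_j
lieVar : Mat → Var → Poly
lieVar X v with Fin.splitAt 4 v
... | inj₁ c = onVst X c
... | inj₂ w with wedgeIdx w
...   | (i , j) = sumF (λ d → (X d i ·P ξ₂ d j) +P (X d j ·P ξ₂ i d))

-- τ_λ for λ = (κ1, κ2, 0): the det^{λ3} factor is trivial (λ3 = 0)
τK : Mat → Poly → Poly
τK k = substP (grpVar k)

τ𝔨 : Mat → Poly → Poly
τ𝔨 X = derivP (lieVar X)

-- 𝔭_ℂ ⊗ V : elements Σ_{ij} E_{ij} ⊗ W_{ij}, stored as the matrix W of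
-- polynomials (for elements of 𝔭_ℂ ⊗ V, W is symmetric)

PMat : Set
PMat = Fin 4 → Fin 4 → Poly

_≈PV_ : PMat → PMat → Set
W ≈PV W' = (i j : Fin 4) → W i j ≈V W' i j

Eᵖ⊗ : Fin 4 → Fin 4 → Poly → PMat
Eᵖ⊗ a b p i j = (E a b i j ⊕ E b a i j) ·P p

infixl 6 _+PM_
infix 8 -PM_
_+PM_ : PMat → PMat → PMat
(W +PM W') i j = W i j +P W' i j

-PM_ : PMat → PMat
(-PM W) i j = -P W i j

adτ : Mat → PMat → PMat
adτ X W i j = sumF (λ l → (X i l ·P W l j) -P (X l j ·P W i l)) +P τ𝔨 X (W i j)

-- (Ad ⊗ τ_λ)(k) W = k W k⁻¹ with k⁻¹ = kᵀ for k ∈ O(4)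
Adτ : Mat → PMat → PMat
Adτ k W i j = sumF (λ a → sumF (λ b → (k i a ⊛ k j b) ·P τK k (W a b)))

ξsq : Poly
ξsq = (ξ zero *P ξ zero) +P (ξ (suc (suc zero)) *P ξ (suc (suc zero)))

ξ24 : Poly
ξ24 = ξ₂ (suc zero) (suc (suc (suc zero)))

w₀ : ℕ → ℕ → Poly
w₀ κ₁ κ₂ = (ξsq ^P ((κ₁ ℕ.∸ κ₂) ℕ./ 2)) *P (ξ24 ^P κ₂)

wpq : ℕ → ℕ → Fin 4 → Fin 4 → Poly
wpq κ₁ κ₂ p q = (ξsq ^P ((κ₁ ℕ.∸ κ₂) ℕ./ 2)) *P (ξ₂ p q *P (ξ24 ^P (κ₂ ℕ.∸ 1)))

wp : ℕ → ℕ → Fin 4 → Poly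
wp κ₁ κ₂ p = (ξsq ^P ((κ₁ ℕ.∸ κ₂ ℕ.∸ 1) ℕ./ 2)) *P (ξ p *P (ξ24 ^P κ₂))

𝟙 𝟚 𝟛 𝟜 : Fin 4
𝟙 = zero
𝟚 = suc zero
𝟛 = suc (suc zero)
𝟜 = suc (suc (suc zero))

wB : ℕ → ℕ → PMat
wB κ₁ κ₂ = Eᵖ⊗ 𝟙 𝟚 (wpq κ₁ κ₂ 𝟙 𝟚) +PM (-PM Eᵖ⊗ 𝟚 𝟛 (wpq κ₁ κ₂ 𝟚 𝟛))
           +PM Eᵖ⊗ 𝟛 𝟜 (wpq κ₁ κ₂ 𝟛 𝟜) +PM Eᵖ⊗ 𝟙 𝟜 (wpq κ₁ κ₂ 𝟙 𝟜)

0PM : PMat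
0PM _ _ = 0P

wC wCbar : ℕ → ℕ → Poly
wC κ₁ κ₂ = wp κ₁ κ₂ 𝟚 +P (√-1 ·P wp κ₁ κ₂ 𝟜)
wCbar κ₁ κ₂ = wp κ₁ κ₂ 𝟚 -P (√-1 ·P wp κ₁ κ₂ 𝟜)

{-# OPTIONS --safe #-}
-- Every vector in the lemma has the form ξsq^a · x · ξ24^b with ξsq = ξ₁² + ξ₃² and x of degree at most
-- one (x = 1, the ξ_pq, or ξ₂ + √-1 ξ₄). E₁₃ and E₂₄ act by derivations that kill ξsq and ξ24, and the
-- diagonal sign matrices m_i act by substitutions fixing ξsq and multiplying ξ24 by ±1. Hence both actions
-- pass through the factors ξsq^a and ξ24^b, up to the sign (±1)^b that the parity hypotheses control, and
-- what remains is a finite computation on x, checked by normalising coefficients. All the identities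
-- already hold in the polynomial ring R, before passing to the quotient by I_R.
module Submission where

open import Defs
open import Data.Nat using (ℕ; zero; suc; _+_; _*_; _≤_; _∸_; _/_)
import Data.Nat.Properties as ℕ
open import Data.Nat.Divisibility using (_∣_; _∤_; divides; ∣m∣n⇒∣m+n; ∣-refl; _∣0)
open import Data.Integer using (+_)
import Data.Integer.Properties as ℤ
import Data.Rational as ℚ
import Data.Rational.Properties as ℚ
import Data.Rational.Unnormalised as ℚᵘ
import Data.Rational.Unnormalised.Properties as ℚᵘ
open import Data.Rational.Solver using (module +-*-Solver)
open import Data.Fin using (Fin; zero; suc)
import Data.Fin.Properties as Fin
open import Data.Vec using (Vec; []; _∷_; lookup; zipWith; replicate; updateAt)
import Data.Vec.Properties as Vec
open import Data.Vec.Relation.Binary.Pointwise.Inductive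
  using (Pointwise-≡⇒≡; zipWith-comm; zipWith-assoc; zipWith-identityˡ)
open import Data.List as List using (List; []; _∷_; _++_; concatMap; length; filter; allFin)
import Data.List.Properties as List
open import Data.Maybe using (Maybe; just; nothing)
open import Data.Bool using (Bool; true; false; T; _∧_; if_then_else_)
open import Data.Product using (_×_; _,_; proj₁; proj₂)
open import Data.Sum using (_⊎_; inj₁; inj₂)
open import Data.Empty using (⊥-elim)
open import Level using (0ℓ)
open import Relation.Nullary using (¬_; Dec; yes; no; ¬?)
open import Relation.Nullary.Decidable using (⌊_⌋; toWitness)
open import Data.Bool.Properties using (T-∧)
open import Function.Bundles using (Equivalence)
open import Function using (_∘_; _∘₂_)
open import Relation.Binary.Definitions using (DecidableEquality; WeaklyDecidable)
open import Relation.Binary.Structures using (IsEquivalence)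
open import Relation.Binary.Bundles using (Setoid)
open import Relation.Binary.PropositionalEquality
open import Relation.Binary.PropositionalEquality.Algebra using (isMagma)
open import Algebra.Bundles using (CommutativeRing)
open import Algebra.Structures using (IsCommutativeRing)
import Algebra.Consequences.Propositional as ≡-Consequences
import Algebra.Consequences.Setoid as Consequences
import Algebra.Solver.Ring.AlmostCommutativeRing as ACR
import Algebra.Solver.Ring.Simple as SimpleRingSolver
import Algebra.Solver.Ring as RingSolver
import Algebra.Properties.Ring as RingProperties
import Algebra.Properties.Semiring.Exp as SemiringExp
import Relation.Binary.Reasoning.Setoid as SetoidReasoning
import Algebra.Properties.CommutativeSemigroup as CommutativeSemigroupProperties

-- The scalars ℚ(i)

module ℚi-laws where
  open +-*-Solver

  ⊕-comm : ∀ x y → x ⊕ y ≡ y ⊕ x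
  ⊕-comm (a +i b) (c +i d) = cong₂ _+i_ (ℚ.+-comm a c) (ℚ.+-comm b d)

  ⊕-assoc : ∀ x y z → (x ⊕ y) ⊕ z ≡ x ⊕ (y ⊕ z)
  ⊕-assoc (a +i b) (c +i d) (e +i f) = cong₂ _+i_ (ℚ.+-assoc a c e) (ℚ.+-assoc b d f)

  ⊕-identityˡ : ∀ x → 0i ⊕ x ≡ x
  ⊕-identityˡ (a +i b) = cong₂ _+i_ (ℚ.+-identityˡ a) (ℚ.+-identityˡ b)

  ⊕-inverseˡ : ∀ x → (⊝ x) ⊕ x ≡ 0i
  ⊕-inverseˡ (a +i b) = cong₂ _+i_ (ℚ.+-inverseˡ a) (ℚ.+-inverseˡ b)

  ⊛-comm : ∀ x y → x ⊛ y ≡ y ⊛ x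
  ⊛-comm (a +i b) (c +i d) = cong₂ _+i_
    (solve 4 (λ a b c d → a :* c :- b :* d := c :* a :- d :* b) refl a b c d)
    (solve 4 (λ a b c d → a :* d :+ b :* c := c :* b :+ d :* a) refl a b c d)

  ⊛-assoc : ∀ x y z → (x ⊛ y) ⊛ z ≡ x ⊛ (y ⊛ z)
  ⊛-assoc (a +i b) (c +i d) (e +i f) = cong₂ _+i_
    (solve 6 (λ a b c d e f → (a :* c :- b :* d) :* e :- (a :* d :+ b :* c) :* f
                           := a :* (c :* e :- d :* f) :- b :* (c :* f :+ d :* e)) refl a b c d e f)
    (solve 6 (λ a b c d e f → (a :* c :- b :* d) :* f :+ (a :* d :+ b :* c) :* e
                           := a :* (c :* f :+ d :* e) :+ b :* (c :* e :- d :* f)) refl a b c d e f)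

  ⊛-identityˡ : ∀ x → 1i ⊛ x ≡ x
  ⊛-identityˡ (a +i b) = cong₂ _+i_
    (solve 2 (λ a b → con ℚ.1ℚ :* a :- con ℚ.0ℚ :* b := a) refl a b)
    (solve 2 (λ a b → con ℚ.1ℚ :* b :+ con ℚ.0ℚ :* a := b) refl a b)

  ⊛-distribˡ : ∀ x y z → x ⊛ (y ⊕ z) ≡ (x ⊛ y) ⊕ (x ⊛ z)
  ⊛-distribˡ (a +i b) (c +i d) (e +i f) = cong₂ _+i_
    (solve 6 (λ a b c d e f → a :* (c :+ e) :- b :* (d :+ f) := (a :* c :- b :* d) :+ (a :* e :- b :* f)) refl a b c d e f)
    (solve 6 (λ a b c d e f → a :* (d :+ f) :+ b :* (c :+ e) := (a :* d :+ b :* c) :+ (a :* f :+ b :* e)) refl a b c d e f)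

ℚi-isCommutativeRing : IsCommutativeRing _≡_ _⊕_ _⊛_ ⊝_ 0i 1i
ℚi-isCommutativeRing = record
  { isRing = record
    { +-isAbelianGroup = record
      { isGroup = record
        { isMonoid = record
          { isSemigroup = record { isMagma = isMagma _⊕_ ; assoc = ⊕-assoc }
          ; identity = comm∧idˡ⇒id ⊕-comm ⊕-identityˡ }
        ; inverse = comm∧invˡ⇒inv ⊕-comm ⊕-inverseˡ
        ; ⁻¹-cong = cong ⊝_ }
      ; comm = ⊕-comm }
    ; *-cong = cong₂ _⊛_
    ; *-assoc = ⊛-assoc
    ; *-identity = comm∧idˡ⇒id ⊛-comm ⊛-identityˡ
    ; distrib = ⊛-distribˡ , comm∧distrˡ⇒distrʳ ⊛-comm ⊛-distribˡ }
  ; *-comm = ⊛-comm }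
  where open ℚi-laws
        open ≡-Consequences

ℚi-commutativeRing : CommutativeRing 0ℓ 0ℓ
ℚi-commutativeRing = record { isCommutativeRing = ℚi-isCommutativeRing }

module ℚ[i] = CommutativeRing ℚi-commutativeRing

_≟ℚi_ : DecidableEquality ℚi
(a +i b) ≟ℚi (c +i d) with a ℚ.≟ c | b ℚ.≟ d
... | yes refl | yes refl = yes refl
... | no a≢c   | _        = no (λ eq → a≢c (cong re eq))
... | _        | no b≢d   = no (λ eq → b≢d (cong im eq))

open CommutativeSemigroupProperties ℚ[i].+-commutativeSemigroup using () renaming (interchange to +-interchange)

open SemiringExp ℚ[i].semiring using (_^_)

module ℚi-Solver = SimpleRingSolver (ACR.fromCommutativeRing ℚi-commutativeRing) _≟ℚi_

ℕ→ℚi-+ : ∀ x y → ℕ→ℚi (x + y) ≡ ℕ→ℚi x ⊕ ℕ→ℚi y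
ℕ→ℚi-+ x y = cong₂ _+i_ ℚ-+ (sym (ℚ.+-identityˡ ℚ.0ℚ))
  where
  ⟦_⟧ : ℕ → ℚᵘ.ℚᵘ
  ⟦ n ⟧ = ℚᵘ.mkℚᵘ (+ n) 0
  -- ℕ→ℚi n is by definition ℚ.fromℚᵘ ⟦ n ⟧, and on unnormalised rationals the sum is a computation
  ⟦⟧-+ : ⟦ x + y ⟧ ℚᵘ.≃ (⟦ x ⟧ ℚᵘ.+ ⟦ y ⟧)
  ⟦⟧-+ = ℚᵘ.*≡* (trans (ℤ.*-identityʳ (+ (x + y))) (trans (ℤ.pos-+ x y)
           (sym (trans (ℤ.*-identityʳ _) (cong₂ Data.Integer._+_ (ℤ.*-identityʳ (+ x)) (ℤ.*-identityʳ (+ y)))))))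
  ℚ-+ : ℚ.fromℚᵘ ⟦ x + y ⟧ ≡ ℚ.fromℚᵘ ⟦ x ⟧ ℚ.+ ℚ.fromℚᵘ ⟦ y ⟧
  ℚ-+ = ℚ.toℚᵘ-injective (ℚᵘ.≃-trans (ℚ.toℚᵘ-fromℚᵘ ⟦ x + y ⟧) (ℚᵘ.≃-trans ⟦⟧-+ (ℚᵘ.≃-sym
          (ℚᵘ.≃-trans (ℚ.toℚᵘ-homo-+ (ℚ.fromℚᵘ ⟦ x ⟧) (ℚ.fromℚᵘ ⟦ y ⟧))
                      (ℚᵘ.+-cong (ℚ.toℚᵘ-fromℚᵘ ⟦ x ⟧) (ℚ.toℚᵘ-fromℚᵘ ⟦ y ⟧))))))

-- Coefficients of polynomials

∑ : {A : Set} → List A → (A → ℚi) → ℚi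
∑ []       f = 0i
∑ (x ∷ xs) f = f x ⊕ ∑ xs f

infix 5 ∑
syntax ∑ xs (λ x → e) = ∑[ x ∈ xs ] e

private variable
  A B : Set

∑-cong : (xs : List A) {f g : A → ℚi} → (∀ x → f x ≡ g x) → ∑ xs f ≡ ∑ xs g
∑-cong []       f≗g = refl
∑-cong (x ∷ xs) f≗g = cong₂ _⊕_ (f≗g x) (∑-cong xs f≗g)

∑-++ : (xs ys : List A) (f : A → ℚi) → ∑ (xs ++ ys) f ≡ ∑ xs f ⊕ ∑ ys f
∑-++ []       ys f = sym (ℚ[i].+-identityˡ _)
∑-++ (x ∷ xs) ys f = trans (cong (f x ⊕_) (∑-++ xs ys f)) (sym (ℚ[i].+-assoc (f x) _ _))

∑-zero : (xs : List A) → ∑[ x ∈ xs ] 0i ≡ 0i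
∑-zero []       = refl
∑-zero (x ∷ xs) = trans (ℚ[i].+-identityˡ _) (∑-zero xs)

∑-⊕ : (xs : List A) (f g : A → ℚi) → ∑[ x ∈ xs ] (f x ⊕ g x) ≡ ∑ xs f ⊕ ∑ xs g
∑-⊕ []       f g = sym (ℚ[i].+-identityˡ 0i)
∑-⊕ (x ∷ xs) f g = trans (cong (f x ⊕ g x ⊕_) (∑-⊕ xs f g)) (+-interchange (f x) (g x) (∑ xs f) (∑ xs g))

∑-⊛ : (xs : List A) (c : ℚi) (f : A → ℚi) → ∑[ x ∈ xs ] (c ⊛ f x) ≡ c ⊛ ∑ xs f
∑-⊛ []       c f = sym (ℚ[i].zeroʳ c)
∑-⊛ (x ∷ xs) c f = trans (cong (c ⊛ f x ⊕_) (∑-⊛ xs c f)) (sym (ℚ[i].distribˡ c _ _))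

∑-map : (g : B → A) (xs : List B) (f : A → ℚi) → ∑ (List.map g xs) f ≡ ∑[ x ∈ xs ] f (g x)
∑-map g []       f = refl
∑-map g (x ∷ xs) f = cong (f (g x) ⊕_) (∑-map g xs f)

∑-concatMap : (g : B → List A) (xs : List B) (f : A → ℚi) →
              ∑ (concatMap g xs) f ≡ ∑[ x ∈ xs ] ∑ (g x) f
∑-concatMap g []       f = refl
∑-concatMap g (x ∷ xs) f = trans (∑-++ (g x) _ f) (cong (∑ (g x) f ⊕_) (∑-concatMap g xs f))

∑-comm : (xs : List A) (ys : List B) (h : A → B → ℚi) →
         ∑[ x ∈ xs ] ∑[ y ∈ ys ] h x y ≡ ∑[ y ∈ ys ] ∑[ x ∈ xs ] h x y
∑-comm []       ys h = sym (∑-zero ys)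
∑-comm (x ∷ xs) ys h =
  trans (cong (∑ ys (h x) ⊕_) (∑-comm xs ys h)) (sym (∑-⊕ ys (h x) (λ y → ∑[ x ∈ xs ] h x y)))

Term : Set
Term = ℚi × Mono

coeffᵗ : Term → Mono → ℚi
coeffᵗ (c , e) μ = if ⌊ Vec.≡-dec ℕ._≟_ e μ ⌋ then c else 0i

module _ (e μ : Mono) where

  coeffᵗ-≡ : ∀ c → e ≡ μ → coeffᵗ (c , e) μ ≡ c
  coeffᵗ-≡ c e≡μ with Vec.≡-dec ℕ._≟_ e μ
  ... | yes _   = refl
  ... | no e≢μ  = ⊥-elim (e≢μ e≡μ)

  coeffᵗ-≢ : ∀ c → e ≢ μ → coeffᵗ (c , e) μ ≡ 0i
  coeffᵗ-≢ c e≢μ with Vec.≡-dec ℕ._≟_ e μ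
  ... | yes e≡μ = ⊥-elim (e≢μ e≡μ)
  ... | no _    = refl

  coeffᵗ-⊛ : ∀ c d → coeffᵗ (c ⊛ d , e) μ ≡ c ⊛ coeffᵗ (d , e) μ
  coeffᵗ-⊛ c d with Vec.≡-dec ℕ._≟_ e μ
  ... | yes _ = refl
  ... | no _  = sym (ℚ[i].zeroʳ c)

  coeffᵗ-⊕ : ∀ c d → coeffᵗ (c ⊕ d , e) μ ≡ coeffᵗ (c , e) μ ⊕ coeffᵗ (d , e) μ
  coeffᵗ-⊕ c d with Vec.≡-dec ℕ._≟_ e μ
  ... | yes _ = refl
  ... | no _  = sym (ℚ[i].+-identityˡ 0i)

  coeffᵗ-0 : coeffᵗ (0i , e) μ ≡ 0i
  coeffᵗ-0 with Vec.≡-dec ℕ._≟_ e μ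
  ... | yes _ = refl
  ... | no _  = refl

coeffᵗ-cong : ∀ {e μ e′ μ′} c → (e ≡ μ → e′ ≡ μ′) → (e′ ≡ μ′ → e ≡ μ) →
              coeffᵗ (c , e) μ ≡ coeffᵗ (c , e′) μ′
coeffᵗ-cong {e} {μ} {e′} {μ′} c to from with Vec.≡-dec ℕ._≟_ e μ | Vec.≡-dec ℕ._≟_ e′ μ′
... | yes _   | yes _    = refl
... | no _    | no _     = refl
... | yes e≡μ | no e′≢μ′ = ⊥-elim (e′≢μ′ (to e≡μ))
... | no e≢μ  | yes e′≡μ′ = ⊥-elim (e≢μ (from e′≡μ′))

coeff-∷ : ∀ t p μ → coeff (t ∷ p) μ ≡ coeffᵗ t μ ⊕ coeff p μ
coeff-∷ (c , e) p μ with Vec.≡-dec ℕ._≟_ e μ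
... | yes _ = refl
... | no _  = sym (ℚ[i].+-identityˡ _)

coeff≡∑ : ∀ p μ → coeff p μ ≡ ∑[ t ∈ p ] coeffᵗ t μ
coeff≡∑ []      μ = refl
coeff≡∑ (t ∷ p) μ = trans (coeff-∷ t p μ) (cong (coeffᵗ t μ ⊕_) (coeff≡∑ p μ))

coeff-++ : ∀ p q μ → coeff (p +P q) μ ≡ coeff p μ ⊕ coeff q μ
coeff-++ p q μ = begin
  coeff (p ++ q) μ                              ≡⟨ coeff≡∑ (p ++ q) μ ⟩
  ∑ (p ++ q) (λ t → coeffᵗ t μ)                 ≡⟨ ∑-++ p q _ ⟩
  ∑ p (λ t → coeffᵗ t μ) ⊕ ∑ q (λ t → coeffᵗ t μ) ≡⟨ sym (cong₂ _⊕_ (coeff≡∑ p μ) (coeff≡∑ q μ)) ⟩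
  coeff p μ ⊕ coeff q μ                         ∎
  where open ≡-Reasoning

coeff-· : ∀ c p μ → coeff (c ·P p) μ ≡ c ⊛ coeff p μ
coeff-· c p μ = begin
  coeff (c ·P p) μ                              ≡⟨ coeff≡∑ (c ·P p) μ ⟩
  ∑ (c ·P p) (λ t → coeffᵗ t μ)                ≡⟨ ∑-map _ p _ ⟩
  ∑[ t ∈ p ] coeffᵗ (c ⊛ proj₁ t , proj₂ t) μ   ≡⟨ ∑-cong p (λ t → coeffᵗ-⊛ (proj₂ t) μ c (proj₁ t)) ⟩
  ∑[ t ∈ p ] c ⊛ coeffᵗ t μ                     ≡⟨ ∑-⊛ p c _ ⟩
  c ⊛ (∑[ t ∈ p ] coeffᵗ t μ)                   ≡⟨ cong (c ⊛_) (sym (coeff≡∑ p μ)) ⟩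
  c ⊛ coeff p μ                                 ∎
  where open ≡-Reasoning

_+ᵐ_ : ∀ {n} → Vec ℕ n → Vec ℕ n → Vec ℕ n
_+ᵐ_ = zipWith _+_

_·ᵗ_ : Term → Term → Term
(c , e) ·ᵗ (d , f) = (c ⊛ d , e +ᵐ f)

coeff-*-∑∑ : ∀ p q μ → coeff (p *P q) μ ≡ ∑[ t ∈ p ] ∑[ u ∈ q ] coeffᵗ (t ·ᵗ u) μ
coeff-*-∑∑ p q μ = begin
  coeff (p *P q) μ                                    ≡⟨ coeff≡∑ (p *P q) μ ⟩
  ∑ (p *P q) (λ s → coeffᵗ s μ)                       ≡⟨ ∑-concatMap _ p _ ⟩
  ∑[ t ∈ p ] ∑ (List.map (t ·ᵗ_) q) (λ s → coeffᵗ s μ) ≡⟨ ∑-cong p (λ t → ∑-map (t ·ᵗ_) q _) ⟩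
  ∑[ t ∈ p ] ∑[ u ∈ q ] coeffᵗ (t ·ᵗ u) μ              ∎
  where open ≡-Reasoning

_/ᵐ_ : ∀ {n} → Vec ℕ n → Vec ℕ n → Maybe (Vec ℕ n)
[]      /ᵐ []      = just []
(x ∷ μ) /ᵐ (y ∷ e) with y ℕ.≤? x | μ /ᵐ e
... | yes _ | just f  = just ((x ∸ y) ∷ f)
... | yes _ | nothing = nothing
... | no _  | _       = nothing

data Quotientᵐ {n} (μ e : Vec ℕ n) : Maybe (Vec ℕ n) → Set where
  exact : ∀ f → (∀ g → e +ᵐ g ≡ μ → g ≡ f) → e +ᵐ f ≡ μ → Quotientᵐ μ e (just f)
  none  : (∀ g → e +ᵐ g ≢ μ) → Quotientᵐ μ e nothing

quotientᵐ : ∀ {n} (μ e : Vec ℕ n) → Quotientᵐ μ e (μ /ᵐ e)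
quotientᵐ []      []      = exact [] (λ { [] _ → refl }) refl
quotientᵐ (x ∷ μ) (y ∷ e) with y ℕ.≤? x | μ /ᵐ e | quotientᵐ μ e
... | yes y≤x | just f  | exact .f unique e+f≡μ = exact _
  (λ { (g₀ ∷ g) eq → cong₂ _∷_ (trans (sym (ℕ.m+n∸m≡n y g₀)) (cong (_∸ y) (Vec.∷-injectiveˡ eq)))
                               (unique g (Vec.∷-injectiveʳ eq)) })
  (cong₂ _∷_ (ℕ.m+[n∸m]≡n y≤x) e+f≡μ)
... | yes _   | nothing | none e∤μ = none (λ { (g₀ ∷ g) eq → e∤μ g (Vec.∷-injectiveʳ eq) })
... | no y≰x  | _       | _        =
  none (λ { (g₀ ∷ g) eq → y≰x (ℕ.≤-trans (ℕ.m≤m+n y g₀) (ℕ.≤-reflexive (Vec.∷-injectiveˡ eq))) })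

coeff/ : Poly → Mono → Mono → ℚi
coeff/ q μ e with μ /ᵐ e
... | just f  = coeff q f
... | nothing = 0i

∑-coeffᵗ-shift : ∀ q μ e → ∑[ u ∈ q ] coeffᵗ (proj₁ u , e +ᵐ proj₂ u) μ ≡ coeff/ q μ e
∑-coeffᵗ-shift q μ e with μ /ᵐ e | quotientᵐ μ e
... | just f  | exact .f unique e+f≡μ =
  trans (∑-cong q (λ u → coeffᵗ-cong (proj₁ u) (unique (proj₂ u)) (λ eq → trans (cong (e +ᵐ_) eq) e+f≡μ)))
        (sym (coeff≡∑ q f))
... | nothing | none e∤μ = trans (∑-cong q (λ u → coeffᵗ-≢ _ μ (proj₁ u) (e∤μ (proj₂ u)))) (∑-zero q)

coeff-* : ∀ p q μ → coeff (p *P q) μ ≡ ∑[ t ∈ p ] proj₁ t ⊛ coeff/ q μ (proj₂ t)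
coeff-* p q μ = trans (coeff-*-∑∑ p q μ) (∑-cong p λ t → begin
  ∑[ u ∈ q ] coeffᵗ (t ·ᵗ u) μ                              ≡⟨ ∑-cong q (λ u → coeffᵗ-⊛ _ μ (proj₁ t) (proj₁ u)) ⟩
  ∑[ u ∈ q ] proj₁ t ⊛ coeffᵗ (proj₁ u , proj₂ t +ᵐ proj₂ u) μ ≡⟨ ∑-⊛ q (proj₁ t) _ ⟩
  proj₁ t ⊛ (∑[ u ∈ q ] coeffᵗ (proj₁ u , proj₂ t +ᵐ proj₂ u) μ) ≡⟨ cong (proj₁ t ⊛_) (∑-coeffᵗ-shift q μ (proj₂ t)) ⟩
  proj₁ t ⊛ coeff/ q μ (proj₂ t)                            ∎)
  where open ≡-Reasoning

+ᵐ-comm : ∀ {n} (e f : Vec ℕ n) → e +ᵐ f ≡ f +ᵐ e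
+ᵐ-comm e f = Pointwise-≡⇒≡ (zipWith-comm ℕ.+-comm e f)

+ᵐ-assoc : ∀ {n} (e f g : Vec ℕ n) → (e +ᵐ f) +ᵐ g ≡ e +ᵐ (f +ᵐ g)
+ᵐ-assoc e f g = Pointwise-≡⇒≡ (zipWith-assoc ℕ.+-assoc e f g)

+ᵐ-identityˡ : ∀ {n} (e : Vec ℕ n) → replicate n 0 +ᵐ e ≡ e
+ᵐ-identityˡ e = Pointwise-≡⇒≡ (zipWith-identityˡ ℕ.+-identityˡ e)

-- The ring of polynomials

-- _≈P_ wrapped in a record, so that both polynomials can be inferred from an equation between them
infix 4 _≈_
record _≈_ (p q : Poly) : Set where
  constructor mk≈
  field coeff-≡ : p ≈P q
open _≈_ public

≈-refl : ∀ {p} → p ≈ p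
≈-refl = mk≈ λ μ → refl

≈-reflexive : ∀ {p q} → p ≡ q → p ≈ q
≈-reflexive refl = ≈-refl

≈-sym : ∀ {p q} → p ≈ q → q ≈ p
≈-sym p≈q = mk≈ λ μ → sym (coeff-≡ p≈q μ)

≈-trans : ∀ {p q r} → p ≈ q → q ≈ r → p ≈ r
≈-trans p≈q q≈r = mk≈ λ μ → trans (coeff-≡ p≈q μ) (coeff-≡ q≈r μ)

≈-isEquivalence : IsEquivalence _≈_
≈-isEquivalence = record { refl = ≈-refl ; sym = ≈-sym ; trans = ≈-trans }

≈-setoid : Setoid 0ℓ 0ℓ
≈-setoid = record { isEquivalence = ≈-isEquivalence }

+-cong : ∀ {p p′ q q′} → p ≈ p′ → q ≈ q′ → p +P q ≈ p′ +P q′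
+-cong {p} {p′} {q} {q′} p≈p′ q≈q′ = mk≈ λ μ →
  trans (coeff-++ p q μ) (trans (cong₂ _⊕_ (coeff-≡ p≈p′ μ) (coeff-≡ q≈q′ μ)) (sym (coeff-++ p′ q′ μ)))

+-comm : ∀ p q → p +P q ≈ q +P p
+-comm p q = mk≈ λ μ → trans (coeff-++ p q μ) (trans (ℚ[i].+-comm (coeff p μ) (coeff q μ)) (sym (coeff-++ q p μ)))

+-assoc : ∀ p q r → (p +P q) +P r ≈ p +P (q +P r)
+-assoc p q r = ≈-reflexive (List.++-assoc p q r)

+-identityˡ : ∀ p → 0P +P p ≈ p
+-identityˡ p = ≈-refl

+-identityʳ : ∀ p → p +P 0P ≈ p
+-identityʳ p = ≈-reflexive (List.++-identityʳ p)

·-cong : ∀ c {p q} → p ≈ q → c ·P p ≈ c ·P q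
·-cong c {p} {q} p≈q = mk≈ λ μ → trans (coeff-· c p μ) (trans (cong (c ⊛_) (coeff-≡ p≈q μ)) (sym (coeff-· c q μ)))

·-assoc : ∀ c d p → c ·P (d ·P p) ≈ (c ⊛ d) ·P p
·-assoc c d p = mk≈ λ μ → begin
  coeff (c ·P (d ·P p)) μ ≡⟨ coeff-· c (d ·P p) μ ⟩
  c ⊛ coeff (d ·P p) μ    ≡⟨ cong (c ⊛_) (coeff-· d p μ) ⟩
  c ⊛ (d ⊛ coeff p μ)     ≡⟨ ℚ[i].*-assoc c d (coeff p μ) ⟨
  (c ⊛ d) ⊛ coeff p μ     ≡⟨ coeff-· (c ⊛ d) p μ ⟨
  coeff ((c ⊛ d) ·P p) μ  ∎
  where open ≡-Reasoning

·-comm : ∀ c d p → c ·P (d ·P p) ≈ d ·P (c ·P p)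
·-comm c d p = ≈-trans (·-assoc c d p) (≈-trans (≈-reflexive (cong (_·P p) (ℚ[i].*-comm c d))) (≈-sym (·-assoc d c p)))

·-distribˡ : ∀ c p q → c ·P (p +P q) ≈ c ·P p +P c ·P q
·-distribˡ c p q = ≈-reflexive (List.map-++ _ p q)

·-distribʳ : ∀ c d p → (c ⊕ d) ·P p ≈ c ·P p +P d ·P p
·-distribʳ c d p = mk≈ λ μ → begin
  coeff ((c ⊕ d) ·P p) μ                      ≡⟨ coeff-· (c ⊕ d) p μ ⟩
  (c ⊕ d) ⊛ coeff p μ                         ≡⟨ ℚ[i].distribʳ (coeff p μ) c d ⟩
  c ⊛ coeff p μ ⊕ d ⊛ coeff p μ               ≡⟨ cong₂ _⊕_ (coeff-· c p μ) (coeff-· d p μ) ⟨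
  coeff (c ·P p) μ ⊕ coeff (d ·P p) μ         ≡⟨ coeff-++ (c ·P p) (d ·P p) μ ⟨
  coeff (c ·P p +P d ·P p) μ                  ∎
  where open ≡-Reasoning

·-identityˡ : ∀ p → 1i ·P p ≈ p
·-identityˡ p = mk≈ λ μ → trans (coeff-· 1i p μ) (ℚ[i].*-identityˡ (coeff p μ))

·-zeroˡ : ∀ p → 0i ·P p ≈ 0P
·-zeroˡ p = mk≈ λ μ → trans (coeff-· 0i p μ) (ℚ[i].zeroˡ (coeff p μ))

·-identity′ : ∀ {c} → c ≡ 1i → ∀ p → c ·P p ≈ p
·-identity′ refl = ·-identityˡ

·-zero′ : ∀ {c} → c ≡ 0i → ∀ p → c ·P p ≈ 0P
·-zero′ refl = ·-zeroˡ

-‿inverseˡ : ∀ p → -P p +P p ≈ 0P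
-‿inverseˡ p = begin
  -P p +P p                ≈⟨ +-cong ≈-refl (·-identityˡ p) ⟨
  (⊝ 1i) ·P p +P 1i ·P p   ≈⟨ ·-distribʳ (⊝ 1i) 1i p ⟨
  ((⊝ 1i) ⊕ 1i) ·P p       ≡⟨ cong (_·P p) (ℚ[i].-‿inverseˡ 1i) ⟩
  0i ·P p                  ≈⟨ ·-zeroˡ p ⟩
  0P                       ∎
  where open SetoidReasoning ≈-setoid

coeff/-cong : ∀ {q q′} μ e → q ≈ q′ → coeff/ q μ e ≡ coeff/ q′ μ e
coeff/-cong μ e q≈q′ with μ /ᵐ e
... | just f  = coeff-≡ q≈q′ f
... | nothing = refl

*-congˡ : ∀ p {q q′} → q ≈ q′ → p *P q ≈ p *P q′
*-congˡ p {q} {q′} q≈q′ = mk≈ λ μ → trans (coeff-* p q μ)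
  (trans (∑-cong p (λ t → cong (proj₁ t ⊛_) (coeff/-cong μ (proj₂ t) q≈q′))) (sym (coeff-* p q′ μ)))

*-comm : ∀ p q → p *P q ≈ q *P p
*-comm p q = mk≈ λ μ → begin
  coeff (p *P q) μ                          ≡⟨ coeff-*-∑∑ p q μ ⟩
  ∑[ t ∈ p ] ∑[ u ∈ q ] coeffᵗ (t ·ᵗ u) μ   ≡⟨ ∑-comm p q _ ⟩
  ∑[ u ∈ q ] ∑[ t ∈ p ] coeffᵗ (t ·ᵗ u) μ   ≡⟨ ∑-cong q (λ u → ∑-cong p (λ t → cong₂ (λ c e → coeffᵗ (c , e) μ)
                                                 (ℚ[i].*-comm (proj₁ t) (proj₁ u)) (+ᵐ-comm (proj₂ t) (proj₂ u)))) ⟩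
  ∑[ u ∈ q ] ∑[ t ∈ p ] coeffᵗ (u ·ᵗ t) μ   ≡⟨ coeff-*-∑∑ q p μ ⟨
  coeff (q *P p) μ                          ∎
  where open ≡-Reasoning

*-congʳ : ∀ {p p′} q → p ≈ p′ → p *P q ≈ p′ *P q
*-congʳ {p} {p′} q p≈p′ = ≈-trans (*-comm p q) (≈-trans (*-congˡ q p≈p′) (*-comm q p′))

*-cong : ∀ {p p′ q q′} → p ≈ p′ → q ≈ q′ → p *P q ≈ p′ *P q′
*-cong {p′ = p′} {q = q} p≈p′ q≈q′ = ≈-trans (*-congʳ q p≈p′) (*-congˡ p′ q≈q′)

∑-* : ∀ p q (h : Term → ℚi) → ∑ (p *P q) h ≡ ∑[ t ∈ p ] ∑[ u ∈ q ] h (t ·ᵗ u)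
∑-* p q h = trans (∑-concatMap _ p h) (∑-cong p (λ t → ∑-map (t ·ᵗ_) q h))

*-assoc : ∀ p q r → (p *P q) *P r ≈ p *P (q *P r)
*-assoc p q r = mk≈ λ μ → begin
  coeff ((p *P q) *P r) μ                                        ≡⟨ coeff-*-∑∑ (p *P q) r μ ⟩
  ∑[ s ∈ p *P q ] ∑[ v ∈ r ] coeffᵗ (s ·ᵗ v) μ                   ≡⟨ ∑-* p q _ ⟩
  ∑[ t ∈ p ] ∑[ u ∈ q ] ∑[ v ∈ r ] coeffᵗ ((t ·ᵗ u) ·ᵗ v) μ      ≡⟨ ∑-cong p (λ t → ∑-cong q (λ u → ∑-cong r (λ v →
                                                                      cong₂ (λ c e → coeffᵗ (c , e) μ)
                                                                        (ℚ[i].*-assoc (proj₁ t) (proj₁ u) (proj₁ v))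
                                                                        (+ᵐ-assoc (proj₂ t) (proj₂ u) (proj₂ v))))) ⟩
  ∑[ t ∈ p ] ∑[ u ∈ q ] ∑[ v ∈ r ] coeffᵗ (t ·ᵗ (u ·ᵗ v)) μ      ≡⟨ ∑-cong p (λ t → ∑-* q r _) ⟨
  ∑[ t ∈ p ] ∑[ s ∈ q *P r ] coeffᵗ (t ·ᵗ s) μ                   ≡⟨ coeff-*-∑∑ p (q *P r) μ ⟨
  coeff (p *P (q *P r)) μ                                        ∎
  where open ≡-Reasoning

*-distribʳ : ∀ r p q → (p +P q) *P r ≈ p *P r +P q *P r
*-distribʳ r p q = mk≈ λ μ → begin
  coeff ((p ++ q) *P r) μ                  ≡⟨ coeff-*-∑∑ (p ++ q) r μ ⟩
  ∑ (p ++ q) (λ t → ∑[ u ∈ r ] coeffᵗ (t ·ᵗ u) μ) ≡⟨ ∑-++ p q _ ⟩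
  (∑[ t ∈ p ] ∑[ u ∈ r ] coeffᵗ (t ·ᵗ u) μ) ⊕ (∑[ t ∈ q ] ∑[ u ∈ r ] coeffᵗ (t ·ᵗ u) μ)
                                           ≡⟨ cong₂ _⊕_ (coeff-*-∑∑ p r μ) (coeff-*-∑∑ q r μ) ⟨
  coeff (p *P r) μ ⊕ coeff (q *P r) μ      ≡⟨ coeff-++ (p *P r) (q *P r) μ ⟨
  coeff (p *P r +P q *P r) μ               ∎
  where open ≡-Reasoning

*-identityˡ : ∀ p → 1P *P p ≈ p
*-identityˡ p = mk≈ λ μ → begin
  coeff (1P *P p) μ                                       ≡⟨ coeff-*-∑∑ 1P p μ ⟩
  (∑[ u ∈ p ] coeffᵗ ((1i , unitMono) ·ᵗ u) μ) ⊕ 0i        ≡⟨ ℚ[i].+-identityʳ _ ⟩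
  ∑[ u ∈ p ] coeffᵗ ((1i , unitMono) ·ᵗ u) μ               ≡⟨ ∑-cong p (λ u → cong₂ (λ c e → coeffᵗ (c , e) μ)
                                                                (ℚ[i].*-identityˡ (proj₁ u)) (+ᵐ-identityˡ (proj₂ u))) ⟩
  ∑[ u ∈ p ] coeffᵗ u μ                                   ≡⟨ coeff≡∑ p μ ⟨
  coeff p μ                                               ∎
  where open ≡-Reasoning

·-*ˡ : ∀ c p q → (c ·P p) *P q ≈ c ·P (p *P q)
·-*ˡ c p q = mk≈ λ μ → begin
  coeff ((c ·P p) *P q) μ                                 ≡⟨ coeff-* (c ·P p) q μ ⟩
  ∑ (c ·P p) (λ t → proj₁ t ⊛ coeff/ q μ (proj₂ t))       ≡⟨ ∑-map _ p _ ⟩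
  ∑[ t ∈ p ] (c ⊛ proj₁ t) ⊛ coeff/ q μ (proj₂ t)         ≡⟨ ∑-cong p (λ t → ℚ[i].*-assoc c (proj₁ t) (coeff/ q μ (proj₂ t))) ⟩
  ∑[ t ∈ p ] c ⊛ (proj₁ t ⊛ coeff/ q μ (proj₂ t))         ≡⟨ ∑-⊛ p c _ ⟩
  c ⊛ (∑[ t ∈ p ] proj₁ t ⊛ coeff/ q μ (proj₂ t))         ≡⟨ cong (c ⊛_) (coeff-* p q μ) ⟨
  c ⊛ coeff (p *P q) μ                                    ≡⟨ coeff-· c (p *P q) μ ⟨
  coeff (c ·P (p *P q)) μ                                 ∎
  where open ≡-Reasoning

·-*ʳ : ∀ c p q → p *P (c ·P q) ≈ c ·P (p *P q)
·-*ʳ c p q = ≈-trans (*-comm p (c ·P q)) (≈-trans (·-*ˡ c q p) (·-cong c (*-comm q p)))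

·-*-· : ∀ c d p q → (c ·P p) *P (d ·P q) ≈ (c ⊛ d) ·P (p *P q)
·-*-· c d p q = ≈-trans (·-*ˡ c p (d ·P q)) (≈-trans (·-cong c (·-*ʳ d p q)) (·-assoc c d (p *P q)))

Poly-isCommutativeRing : IsCommutativeRing _≈_ _+P_ _*P_ -P_ 0P 1P
Poly-isCommutativeRing = record
  { isRing = record
    { +-isAbelianGroup = record
      { isGroup = record
        { isMonoid = record
          { isSemigroup = record { isMagma = record { isEquivalence = ≈-isEquivalence ; ∙-cong = +-cong }
                                 ; assoc = +-assoc }
          ; identity = +-identityˡ , +-identityʳ }
        ; inverse = comm∧invˡ⇒inv +-comm -‿inverseˡ
        ; ⁻¹-cong = ·-cong (⊝ 1i) }
      ; comm = +-comm }
    ; *-cong = *-cong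
    ; *-assoc = *-assoc
    ; *-identity = comm∧idˡ⇒id *-comm *-identityˡ
    ; distrib = comm∧distrʳ⇒distr +-cong *-comm *-distribʳ }
  ; *-comm = *-comm }
  where open Consequences ≈-setoid

Poly-commutativeRing : CommutativeRing 0ℓ 0ℓ
Poly-commutativeRing = record { isCommutativeRing = Poly-isCommutativeRing }

module Poly = CommutativeRing Poly-commutativeRing

≈⇒≈V : ∀ {p q} → p ≈ q → p ≈V q
≈⇒≈V {p} {q} p≈q = [] , coeff-≡ (≈-trans (+-cong p≈q ≈-refl) (Poly.-‿inverseʳ q))

const-homomorphism : ACR._-Raw-AlmostCommutative⟶_ ℚ[i].rawRing (ACR.fromCommutativeRing Poly-commutativeRing)
const-homomorphism = record
  { ⟦_⟧    = const
  ; +-homo = λ c d → mk≈ λ μ → trans (coeff-const (c ⊕ d) μ) (trans (coeffᵗ-⊕ unitMono μ c d)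
                       (sym (trans (coeff-++ (const c) (const d) μ) (cong₂ _⊕_ (coeff-const c μ) (coeff-const d μ)))))
  ; *-homo = λ c d → mk≈ λ μ → trans (coeff-const (c ⊛ d) μ)
                       (sym (trans (coeff-*-∑∑ (const c) (const d) μ)
                         (trans (ℚ[i].+-identityʳ (coeffᵗ (c ⊛ d , unitMono) μ ⊕ 0i))
                                (ℚ[i].+-identityʳ (coeffᵗ (c ⊛ d , unitMono) μ)))))
  ; -‿homo = λ c → mk≈ λ μ → begin
      coeff (const (⊝ c)) μ          ≡⟨ coeff-const (⊝ c) μ ⟩
      coeffᵗ (⊝ c , unitMono) μ      ≡⟨ cong (λ x → coeffᵗ (x , unitMono) μ) (-1*x≈-x c) ⟨
      coeffᵗ ((⊝ 1i) ⊛ c , unitMono) μ ≡⟨ coeffᵗ-⊛ unitMono μ (⊝ 1i) c ⟩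
      (⊝ 1i) ⊛ coeffᵗ (c , unitMono) μ ≡⟨ cong ((⊝ 1i) ⊛_) (coeff-const c μ) ⟨
      (⊝ 1i) ⊛ coeff (const c) μ     ≡⟨ coeff-· (⊝ 1i) (const c) μ ⟨
      coeff (-P const c) μ           ∎
  ; 0-homo = mk≈ λ μ → trans (coeff-const 0i μ) (coeffᵗ-0 unitMono μ)
  ; 1-homo = ≈-refl
  }
  where
  open ≡-Reasoning
  open RingProperties ℚ[i].ring using (-1*x≈-x)
  coeff-const : ∀ c μ → coeff (const c) μ ≡ coeffᵗ (c , unitMono) μ
  coeff-const c μ = trans (coeff-∷ (c , unitMono) [] μ) (ℚ[i].+-identityʳ (coeffᵗ (c , unitMono) μ))

const-≟ : WeaklyDecidable (ACR.Induced-equivalence const-homomorphism)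
const-≟ c d with c ≟ℚi d
... | yes refl = just ≈-refl
... | no _     = nothing

module Poly-Solver = RingSolver ℚ[i].rawRing (ACR.fromCommutativeRing Poly-commutativeRing) const-homomorphism const-≟

-- Partial derivatives

raise : Var → Mono → Mono
raise v μ = updateAt μ v suc

updateAt-+ᵐˡ : ∀ {n} (i : Fin n) (e f : Vec ℕ n) x →
               updateAt (e +ᵐ f) i (λ _ → x + lookup f i) ≡ updateAt e i (λ _ → x) +ᵐ f
updateAt-+ᵐˡ zero    (a ∷ e) (b ∷ f) x = refl
updateAt-+ᵐˡ (suc i) (a ∷ e) (b ∷ f) x = cong (a + b ∷_) (updateAt-+ᵐˡ i e f x)

updateAt-+ᵐʳ : ∀ {n} (i : Fin n) (e f : Vec ℕ n) y →
               updateAt (e +ᵐ f) i (λ _ → lookup e i + y) ≡ e +ᵐ updateAt f i (λ _ → y)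
updateAt-+ᵐʳ zero    (a ∷ e) (b ∷ f) y = refl
updateAt-+ᵐʳ (suc i) (a ∷ e) (b ∷ f) y = cong (a + b ∷_) (updateAt-+ᵐʳ i e f y)

singleton-cong : ∀ {c c′ e e′} → c ≡ c′ → e ≡ e′ → (c , e) ∷ [] ≈ (c′ , e′) ∷ []
singleton-cong refl refl = ≈-refl

singleton-split : ∀ {x y z} e → x ≡ y ⊕ z → (x , e) ∷ [] ≈ (y , e) ∷ (z , e) ∷ []
singleton-split {x} {y} {z} e x≡y+z = mk≈ λ μ → begin
  coeff ((x , e) ∷ []) μ                       ≡⟨ coeff≡∑ ((x , e) ∷ []) μ ⟩
  coeffᵗ (x , e) μ ⊕ 0i                        ≡⟨ ℚ[i].+-identityʳ (coeffᵗ (x , e) μ) ⟩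
  coeffᵗ (x , e) μ                             ≡⟨ cong (λ w → coeffᵗ (w , e) μ) x≡y+z ⟩
  coeffᵗ (y ⊕ z , e) μ                         ≡⟨ coeffᵗ-⊕ e μ y z ⟩
  coeffᵗ (y , e) μ ⊕ coeffᵗ (z , e) μ          ≡⟨ cong (coeffᵗ (y , e) μ ⊕_) (ℚ[i].+-identityʳ (coeffᵗ (z , e) μ)) ⟨
  coeffᵗ (y , e) μ ⊕ (coeffᵗ (z , e) μ ⊕ 0i)   ≡⟨ coeff≡∑ ((y , e) ∷ (z , e) ∷ []) μ ⟨
  coeff ((y , e) ∷ (z , e) ∷ []) μ             ∎
  where open ≡-Reasoning

coeff-∂ᵗ : ∀ v c e μ → coeff (∂ v ((c , e) ∷ [])) μ ≡ ℕ→ℚi (suc (lookup μ v)) ⊛ coeffᵗ (c , e) (raise v μ)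
coeff-∂ᵗ v c e μ with lookup e v in eᵥ
... | zero = sym (trans (cong (N ⊛_) (coeffᵗ-≢ e (raise v μ) c e≢raise)) (ℚ[i].zeroʳ N))
  where
  N = ℕ→ℚi (suc (lookup μ v))
  e≢raise : e ≢ raise v μ
  e≢raise refl with () ← trans (sym eᵥ) (Vec.lookup∘updateAt v {suc} μ)
... | suc k with Vec.≡-dec ℕ._≟_ (updateAt e v (λ _ → k)) μ
...   | yes refl = begin
  c ⊛ ℕ→ℚi (suc k) ⊕ 0i                       ≡⟨ ℚ[i].+-identityʳ (c ⊛ ℕ→ℚi (suc k)) ⟩
  c ⊛ ℕ→ℚi (suc k)                            ≡⟨ ℚ[i].*-comm c (ℕ→ℚi (suc k)) ⟩
  ℕ→ℚi (suc k) ⊛ c                            ≡⟨ cong₂ (λ n x → ℕ→ℚi (suc n) ⊛ x) (sym (Vec.lookup∘updateAt v e))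
                                                        (sym (coeffᵗ-≡ e (raise v μ′) c e≡raise)) ⟩
  ℕ→ℚi (suc (lookup μ′ v)) ⊛ coeffᵗ (c , e) (raise v μ′) ∎
  where
  open ≡-Reasoning
  μ′ = updateAt e v (λ _ → k)
  e≡raise : e ≡ raise v μ′
  e≡raise = sym (trans (Vec.updateAt-updateAt v e) (Vec.updateAt-id-local v e (sym eᵥ)))
...   | no e[v≔k]≢μ =
  sym (trans (cong (ℕ→ℚi (suc (lookup μ v)) ⊛_) (coeffᵗ-≢ e (raise v μ) c e≢raise)) (ℚ[i].zeroʳ (ℕ→ℚi (suc (lookup μ v)))))
  where
  e≢raise : e ≢ raise v μ
  e≢raise refl = e[v≔k]≢μ (trans (Vec.updateAt-updateAt v μ)
                                  (Vec.updateAt-id-local v μ (ℕ.suc-injective (trans (sym eᵥ) (Vec.lookup∘updateAt v {suc} μ)))))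

∂-∷ : ∀ v t p → ∂ v (t ∷ p) ≈ ∂ v (t ∷ []) +P ∂ v p
∂-∷ v (c , e) p with lookup e v
... | zero  = ≈-refl
... | suc k = ≈-refl

coeff-∂ : ∀ v p μ → coeff (∂ v p) μ ≡ ℕ→ℚi (suc (lookup μ v)) ⊛ coeff p (raise v μ)
coeff-∂ v []      μ = sym (ℚ[i].zeroʳ (ℕ→ℚi (suc (lookup μ v))))
coeff-∂ v (t ∷ p) μ = begin
  coeff (∂ v (t ∷ p)) μ                       ≡⟨ coeff-≡ (∂-∷ v t p) μ ⟩
  coeff (∂ v (t ∷ []) +P ∂ v p) μ             ≡⟨ coeff-++ (∂ v (t ∷ [])) (∂ v p) μ ⟩
  coeff (∂ v (t ∷ [])) μ ⊕ coeff (∂ v p) μ    ≡⟨ cong₂ _⊕_ (coeff-∂ᵗ v (proj₁ t) (proj₂ t) μ) (coeff-∂ v p μ) ⟩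
  N ⊛ coeffᵗ t (raise v μ) ⊕ N ⊛ coeff p (raise v μ) ≡⟨ ℚ[i].distribˡ N _ _ ⟨
  N ⊛ (coeffᵗ t (raise v μ) ⊕ coeff p (raise v μ))   ≡⟨ cong (N ⊛_) (coeff-∷ t p (raise v μ)) ⟨
  N ⊛ coeff (t ∷ p) (raise v μ)               ∎
  where
  open ≡-Reasoning
  N = ℕ→ℚi (suc (lookup μ v))

∂-cong : ∀ v {p q} → p ≈ q → ∂ v p ≈ ∂ v q
∂-cong v {p} {q} p≈q = mk≈ λ μ →
  trans (coeff-∂ v p μ) (trans (cong (ℕ→ℚi (suc (lookup μ v)) ⊛_) (coeff-≡ p≈q (raise v μ))) (sym (coeff-∂ v q μ)))

∂-+ : ∀ v p q → ∂ v (p +P q) ≈ ∂ v p +P ∂ v q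
∂-+ v p q = ≈-reflexive (List.concatMap-++ _ p q)

leibnizᵗ : ∀ v c e d f → ∂ v ((c ⊛ d , e +ᵐ f) ∷ []) ≈ ∂ v ((c , e) ∷ []) *P ((d , f) ∷ []) +P ((c , e) ∷ []) *P ∂ v ((d , f) ∷ [])
leibnizᵗ v c e d f rewrite Vec.lookup-zipWith _+_ v e f with lookup e v in eᵥ | lookup f v in fᵥ
... | zero  | zero  = ≈-refl
... | suc a | zero  = singleton-cong coeff≡ mono≡
  where
  coeff≡ : (c ⊛ d) ⊛ ℕ→ℚi (suc (a + 0)) ≡ (c ⊛ ℕ→ℚi (suc a)) ⊛ d
  coeff≡ = trans (cong (λ n → (c ⊛ d) ⊛ ℕ→ℚi (suc n)) (ℕ.+-identityʳ a))
                 (ℚi-Solver.solve 3 (λ c d n → (c :* d) :* n := (c :* n) :* d) refl c d (ℕ→ℚi (suc a)))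
    where open ℚi-Solver using (_:*_; _:=_)
  mono≡ : updateAt (e +ᵐ f) v (λ _ → a + 0) ≡ updateAt e v (λ _ → a) +ᵐ f
  mono≡ = subst (λ z → updateAt (e +ᵐ f) v (λ _ → a + z) ≡ updateAt e v (λ _ → a) +ᵐ f) fᵥ (updateAt-+ᵐˡ v e f a)
... | zero  | suc b = singleton-cong (ℚ[i].*-assoc c d (ℕ→ℚi (suc b))) mono≡
  where
  mono≡ : updateAt (e +ᵐ f) v (λ _ → b) ≡ e +ᵐ updateAt f v (λ _ → b)
  mono≡ = subst (λ z → updateAt (e +ᵐ f) v (λ _ → z + b) ≡ e +ᵐ updateAt f v (λ _ → b)) eᵥ (updateAt-+ᵐʳ v e f b)
... | suc a | suc b = ≈-trans (singleton-split M coeff≡) (+-cong (singleton-cong refl mono≡ˡ) (singleton-cong refl mono≡ʳ))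
  where
  M = updateAt (e +ᵐ f) v (λ _ → a + suc b)
  coeff≡ : (c ⊛ d) ⊛ ℕ→ℚi (suc (a + suc b)) ≡ (c ⊛ ℕ→ℚi (suc a)) ⊛ d ⊕ c ⊛ (d ⊛ ℕ→ℚi (suc b))
  coeff≡ = trans (cong ((c ⊛ d) ⊛_) (ℕ→ℚi-+ (suc a) (suc b)))
                 (ℚi-Solver.solve 4 (λ c d x y → (c :* d) :* (x :+ y) := (c :* x) :* d :+ c :* (d :* y))
                                    refl c d (ℕ→ℚi (suc a)) (ℕ→ℚi (suc b)))
    where open ℚi-Solver using (_:+_; _:*_; _:=_)
  mono≡ˡ : M ≡ updateAt e v (λ _ → a) +ᵐ f
  mono≡ˡ = subst (λ z → updateAt (e +ᵐ f) v (λ _ → a + z) ≡ updateAt e v (λ _ → a) +ᵐ f) fᵥ (updateAt-+ᵐˡ v e f a)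
  mono≡ʳ : M ≡ e +ᵐ updateAt f v (λ _ → b)
  mono≡ʳ = subst (λ z → updateAt (e +ᵐ f) v (λ _ → z) ≡ e +ᵐ updateAt f v (λ _ → b)) (trans (cong (_+ b) eᵥ) (sym (ℕ.+-suc a b)))
                 (updateAt-+ᵐʳ v e f b)

*-∷ˡ : ∀ t p q → (t ∷ p) *P q ≈ (t ∷ []) *P q +P p *P q
*-∷ˡ t p q = ≈-reflexive (cong (_++ (p *P q)) (sym (List.++-identityʳ _)))

∂-*ᵗ : ∀ v t q → ∂ v ((t ∷ []) *P q) ≈ ∂ v (t ∷ []) *P q +P (t ∷ []) *P ∂ v q
∂-*ᵗ v t []                  = ≈-sym (+-cong (Poly.zeroʳ (∂ v (t ∷ []))) (Poly.zeroʳ (t ∷ [])))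
∂-*ᵗ v (c , e) ((d , f) ∷ q) = begin
  ∂ v ((c ⊛ d , e +ᵐ f) ∷ p₁ *P q)                 ≈⟨ ∂-∷ v (c ⊛ d , e +ᵐ f) (p₁ *P q) ⟩
  ∂ v ((c ⊛ d , e +ᵐ f) ∷ []) +P ∂ v (p₁ *P q)     ≈⟨ +-cong (leibnizᵗ v c e d f) (∂-*ᵗ v (c , e) q) ⟩
  (∂p₁ *P q₁ +P p₁ *P ∂q₁) +P (∂p₁ *P q +P p₁ *P ∂ v q) ≈⟨ solve 6 (λ ∂p₁ q₁ p₁ ∂q₁ q ∂q → (∂p₁ :* q₁ :+ p₁ :* ∂q₁) :+ (∂p₁ :* q :+ p₁ :* ∂q)
                                                                 := ∂p₁ :* (q₁ :+ q) :+ p₁ :* (∂q₁ :+ ∂q))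
                                                           ≈-refl ∂p₁ q₁ p₁ ∂q₁ q (∂ v q) ⟩
  ∂p₁ *P (q₁ +P q) +P p₁ *P (∂q₁ +P ∂ v q)           ≈⟨ +-cong (≈-refl {∂p₁ *P ((d , f) ∷ q)}) (*-congˡ p₁ (∂-∷ v (d , f) q)) ⟨
  ∂p₁ *P ((d , f) ∷ q) +P p₁ *P ∂ v ((d , f) ∷ q)   ∎
  where
  open SetoidReasoning ≈-setoid
  open Poly-Solver using (solve; _:+_; _:*_; _:=_)
  p₁ = (c , e) ∷ []
  q₁ = (d , f) ∷ []
  ∂p₁ = ∂ v p₁
  ∂q₁ = ∂ v q₁

∂-* : ∀ v p q → ∂ v (p *P q) ≈ ∂ v p *P q +P p *P ∂ v q
∂-* v []      q = ≈-refl
∂-* v (t ∷ p) q = begin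
  ∂ v ((t ∷ p) *P q)                                     ≈⟨ ∂-cong v (*-∷ˡ t p q) ⟩
  ∂ v (p₁ *P q +P p *P q)                                 ≈⟨ ∂-+ v (p₁ *P q) (p *P q) ⟩
  ∂ v (p₁ *P q) +P ∂ v (p *P q)                           ≈⟨ +-cong (∂-*ᵗ v t q) (∂-* v p q) ⟩
  (∂ v p₁ *P q +P p₁ *P ∂ v q) +P (∂ v p *P q +P p *P ∂ v q) ≈⟨ solve 6 (λ ∂p₁ q p₁ ∂q ∂p p → (∂p₁ :* q :+ p₁ :* ∂q) :+ (∂p :* q :+ p :* ∂q)
                                                                         := (∂p₁ :+ ∂p) :* q :+ (p₁ :+ p) :* ∂q)
                                                                   ≈-refl (∂ v p₁) q p₁ (∂ v q) (∂ v p) p ⟩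
  (∂ v p₁ +P ∂ v p) *P q +P (p₁ +P p) *P ∂ v q             ≈⟨ +-cong (*-congʳ q (∂-∷ v t p)) ≈-refl ⟨
  ∂ v (t ∷ p) *P q +P (t ∷ p) *P ∂ v q                   ∎
  where
  open SetoidReasoning ≈-setoid
  open Poly-Solver using (solve; _:+_; _:*_; _:=_)
  p₁ = t ∷ []

-- Linear maps, derivations and substitutions

record IsLinear (L : Poly → Poly) : Set where
  field
    +-homo : ∀ p q → L (p +P q) ≈ L p +P L q
    ·-homo : ∀ c p → L (c ·P p) ≈ c ·P L p

  0-homo : L 0P ≈ 0P
  0-homo = ≈-trans (·-homo 0i 0P) (·-zeroˡ (L 0P))

  sumF-homo : ∀ {n} (f : Fin n → Poly) → L (sumF f) ≈ sumF (λ i → L (f i))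
  sumF-homo {zero}  f = 0-homo
  sumF-homo {suc n} f = ≈-trans (+-homo (f zero) _) (+-cong ≈-refl (sumF-homo (λ i → f (suc i))))

sumF-cong : ∀ {n} {f g : Fin n → Poly} → (∀ i → f i ≈ g i) → sumF f ≈ sumF g
sumF-cong {zero}  f≈g = ≈-refl
sumF-cong {suc n} f≈g = +-cong (f≈g zero) (sumF-cong (λ i → f≈g (suc i)))

sumF-zero : ∀ {n} {f : Fin n → Poly} → (∀ i → f i ≈ 0P) → sumF f ≈ 0P
sumF-zero {zero}  f≈0 = ≈-refl
sumF-zero {suc n} f≈0 = +-cong (f≈0 zero) (sumF-zero (λ i → f≈0 (suc i)))

sumF-+ : ∀ {n} (f g : Fin n → Poly) → sumF (λ i → f i +P g i) ≈ sumF f +P sumF g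
sumF-+ {zero}  f g = ≈-refl
sumF-+ {suc n} f g = ≈-trans (+-cong ≈-refl (sumF-+ (λ i → f (suc i)) (λ i → g (suc i))))
                             (interchange (f zero) (g zero) _ _)
  where open CommutativeSemigroupProperties Poly.+-commutativeSemigroup using (interchange)

sumF-*ʳ : ∀ {n} (f : Fin n → Poly) q → sumF (λ i → f i *P q) ≈ sumF f *P q
sumF-*ʳ {zero}  f q = ≈-refl
sumF-*ʳ {suc n} f q = ≈-trans (+-cong ≈-refl (sumF-*ʳ (λ i → f (suc i)) q)) (≈-sym (*-distribʳ q (f zero) _))

sumF-*ˡ : ∀ {n} (f : Fin n → Poly) q → sumF (λ i → q *P f i) ≈ q *P sumF f
sumF-*ˡ f q = ≈-trans (sumF-cong (λ i → *-comm q (f i))) (≈-trans (sumF-*ʳ f q) (*-comm (sumF f) q))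

derivP-cong : ∀ d {p q} → p ≈ q → derivP d p ≈ derivP d q
derivP-cong d p≈q = sumF-cong (λ v → *-congʳ (d v) (∂-cong v p≈q))

derivP-* : ∀ d p q → derivP d (p *P q) ≈ derivP d p *P q +P p *P derivP d q
derivP-* d p q = begin
  sumF (λ v → ∂ v (p *P q) *P d v)                                  ≈⟨ sumF-cong (λ v → *-congʳ (d v) (∂-* v p q)) ⟩
  sumF (λ v → (∂ v p *P q +P p *P ∂ v q) *P d v)                    ≈⟨ sumF-cong (λ v → solve 5
                                                                         (λ ∂p q p ∂q dv → (∂p :* q :+ p :* ∂q) :* dv := ∂p :* dv :* q :+ p :* (∂q :* dv))
                                                                         ≈-refl (∂ v p) q p (∂ v q) (d v)) ⟩
  sumF (λ v → (∂ v p *P d v) *P q +P p *P (∂ v q *P d v))           ≈⟨ sumF-+ (λ v → (∂ v p *P d v) *P q) (λ v → p *P (∂ v q *P d v)) ⟩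
  sumF (λ v → (∂ v p *P d v) *P q) +P sumF (λ v → p *P (∂ v q *P d v)) ≈⟨ +-cong (sumF-*ʳ (λ v → ∂ v p *P d v) q) (sumF-*ˡ (λ v → ∂ v q *P d v) p) ⟩
  derivP d p *P q +P p *P derivP d q                                ∎
  where
  open SetoidReasoning ≈-setoid
  open Poly-Solver using (solve; _:+_; _:*_; _:=_)

-- derivP sums over the ten concrete variables, and ∂ v 1P reduces to 0P for each of them
derivP-1 : ∀ d → derivP d 1P ≈ 0P
derivP-1 d = ≈-refl

derivP-^ : ∀ d {p} n → derivP d p ≈ 0P → derivP d (p ^P n) ≈ 0P
derivP-^ d zero    dp≈0 = derivP-1 d
derivP-^ d {p} (suc n) dp≈0 = begin
  derivP d (p *P p ^P n)                        ≈⟨ derivP-* d p (p ^P n) ⟩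
  derivP d p *P p ^P n +P p *P derivP d (p ^P n) ≈⟨ +-cong (*-congʳ (p ^P n) dp≈0) (*-congˡ p (derivP-^ d n dp≈0)) ⟩
  0P *P p ^P n +P p *P 0P                       ≈⟨ +-cong (Poly.zeroˡ (p ^P n)) (Poly.zeroʳ p) ⟩
  0P                                            ∎
  where open SetoidReasoning ≈-setoid

^P-cong : ∀ {p q} n → p ≈ q → p ^P n ≈ q ^P n
^P-cong zero    p≈q = ≈-refl
^P-cong (suc n) p≈q = *-cong p≈q (^P-cong n p≈q)

^P-+ : ∀ p m n → p ^P (m + n) ≈ p ^P m *P p ^P n
^P-+ p zero    n = ≈-sym (*-identityˡ (p ^P n))
^P-+ p (suc m) n = ≈-trans (*-congˡ p (^P-+ p m n)) (≈-sym (*-assoc p (p ^P m) (p ^P n)))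

·-^P : ∀ c p n → (c ·P p) ^P n ≈ (c ^ n) ·P p ^P n
·-^P c p zero    = ≈-sym (·-identityˡ 1P)
·-^P c p (suc n) = begin
  (c ·P p) *P (c ·P p) ^P n        ≈⟨ *-congˡ (c ·P p) (·-^P c p n) ⟩
  (c ·P p) *P ((c ^ n) ·P p ^P n)  ≈⟨ ·-*ˡ c p _ ⟩
  c ·P (p *P ((c ^ n) ·P p ^P n))  ≈⟨ ·-cong c (·-*ʳ (c ^ n) p (p ^P n)) ⟩
  c ·P ((c ^ n) ·P p ^P suc n)     ≈⟨ ·-assoc c (c ^ n) (p ^P suc n) ⟩
  (c ⊛ c ^ n) ·P p ^P suc n        ∎
  where open SetoidReasoning ≈-setoid

-- definitionally equal to the evaluation of a monomial inside substP
evalMono : (Var → Poly) → List Var → Mono → Poly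
evalMono s []       e = 1P
evalMono s (v ∷ vs) e = s v ^P lookup e v *P evalMono s vs e

evalMono-+ᵐ : ∀ s vs e f → evalMono s vs (e +ᵐ f) ≈ evalMono s vs e *P evalMono s vs f
evalMono-+ᵐ s []       e f = ≈-sym (*-identityˡ 1P)
evalMono-+ᵐ s (v ∷ vs) e f = begin
  s v ^P lookup (e +ᵐ f) v *P evalMono s vs (e +ᵐ f)
    ≡⟨ cong (λ n → s v ^P n *P evalMono s vs (e +ᵐ f)) (Vec.lookup-zipWith _+_ v e f) ⟩
  s v ^P (lookup e v + lookup f v) *P evalMono s vs (e +ᵐ f)
    ≈⟨ *-cong (^P-+ (s v) (lookup e v) (lookup f v)) (evalMono-+ᵐ s vs e f) ⟩
  (sᵉ *P sᶠ) *P (evalMono s vs e *P evalMono s vs f)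
    ≈⟨ interchange sᵉ sᶠ (evalMono s vs e) (evalMono s vs f) ⟩
  (sᵉ *P evalMono s vs e) *P (sᶠ *P evalMono s vs f) ∎
  where
  open SetoidReasoning ≈-setoid
  open CommutativeSemigroupProperties Poly.*-commutativeSemigroup using (interchange)
  sᵉ = s v ^P lookup e v
  sᶠ = s v ^P lookup f v

module _ (s : Var → Poly) where

  private
    ⟦_⟧ : Mono → Poly
    ⟦ e ⟧ = evalMono s (allFin 10) e

  substP-+ : ∀ p q → substP s (p +P q) ≈ substP s p +P substP s q
  substP-+ []            q = ≈-refl
  substP-+ ((c , e) ∷ p) q = ≈-trans (+-cong ≈-refl (substP-+ p q)) (≈-sym (+-assoc (c ·P ⟦ e ⟧) (substP s p) (substP s q)))

  substP-· : ∀ c p → substP s (c ·P p) ≈ c ·P substP s p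
  substP-· c []            = ≈-refl
  substP-· c ((d , e) ∷ p) =
    ≈-trans (+-cong (≈-sym (·-assoc c d ⟦ e ⟧)) (substP-· c p)) (≈-sym (·-distribˡ c (d ·P ⟦ e ⟧) (substP s p)))

  substP-isLinear : IsLinear (substP s)
  substP-isLinear = record { +-homo = substP-+ ; ·-homo = substP-· }

  substP-*ᵗ : ∀ c e q → substP s (List.map ((c , e) ·ᵗ_) q) ≈ (c ·P ⟦ e ⟧) *P substP s q
  substP-*ᵗ c e []            = ≈-sym (Poly.zeroʳ (c ·P ⟦ e ⟧))
  substP-*ᵗ c e ((d , f) ∷ q) = begin
    (c ⊛ d) ·P ⟦ e +ᵐ f ⟧ +P substP s (List.map ((c , e) ·ᵗ_) q)
      ≈⟨ +-cong (·-cong (c ⊛ d) (evalMono-+ᵐ s (allFin 10) e f)) (substP-*ᵗ c e q) ⟩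
    (c ⊛ d) ·P (⟦ e ⟧ *P ⟦ f ⟧) +P (c ·P ⟦ e ⟧) *P substP s q
      ≈⟨ +-cong (·-*-· c d ⟦ e ⟧ ⟦ f ⟧) ≈-refl ⟨
    (c ·P ⟦ e ⟧) *P (d ·P ⟦ f ⟧) +P (c ·P ⟦ e ⟧) *P substP s q
      ≈⟨ Poly.distribˡ (c ·P ⟦ e ⟧) (d ·P ⟦ f ⟧) (substP s q) ⟨
    (c ·P ⟦ e ⟧) *P (d ·P ⟦ f ⟧ +P substP s q) ∎
    where open SetoidReasoning ≈-setoid

  substP-* : ∀ p q → substP s (p *P q) ≈ substP s p *P substP s q
  substP-* []            q = ≈-refl
  substP-* ((c , e) ∷ p) q = begin
    substP s (List.map ((c , e) ·ᵗ_) q ++ p *P q)                    ≈⟨ substP-+ (List.map ((c , e) ·ᵗ_) q) (p *P q) ⟩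
    substP s (List.map ((c , e) ·ᵗ_) q) +P substP s (p *P q)         ≈⟨ +-cong (substP-*ᵗ c e q) (substP-* p q) ⟩
    (c ·P ⟦ e ⟧) *P substP s q +P substP s p *P substP s q           ≈⟨ *-distribʳ (substP s q) (c ·P ⟦ e ⟧) (substP s p) ⟨
    (c ·P ⟦ e ⟧ +P substP s p) *P substP s q                         ∎
    where open SetoidReasoning ≈-setoid

  substP-single : ∀ c e → substP s ((c , e) ∷ []) ≈ c ·P ⟦ e ⟧
  substP-single c e = +-identityʳ (c ·P ⟦ e ⟧)

  -- The endpoints of subst are explicit and unitMono is abstracted as e: otherwise the type checker
  -- evaluates substP s on the concrete monomial, which exhausts memory.
  substP-1 : substP s 1P ≈ 1P
  substP-1 = subst (λ p → substP s p ≈ 1P) {x = (1i , unitMono) ∷ []} {y = 1P} refl (substP-unit unitMono refl)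
    where
    evalMono-unit : ∀ e vs → e ≡ unitMono → evalMono s vs e ≈ 1P
    evalMono-unit e []       e≡1 = ≈-refl
    evalMono-unit e (v ∷ vs) refl =
      ≈-trans (≈-reflexive (cong (λ n → s v ^P n *P evalMono s vs unitMono) (Vec.lookup-replicate v 0)))
              (≈-trans (*-identityˡ (evalMono s vs unitMono)) (evalMono-unit unitMono vs refl))
    substP-unit : ∀ e → e ≡ unitMono → substP s ((1i , e) ∷ []) ≈ 1P
    substP-unit e e≡1 = ≈-trans (substP-single 1i e) (≈-trans (·-identityˡ ⟦ e ⟧) (evalMono-unit e (allFin 10) e≡1))

  substP-^ : ∀ p n → substP s (p ^P n) ≈ substP s p ^P n
  substP-^ p zero    = subst (λ q → substP s q ≈ 1P) {x = 1P} {y = p ^P zero} refl substP-1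
  substP-^ p (suc n) = ≈-trans (substP-* p (p ^P n)) (*-congˡ (substP s p) (substP-^ p n))

-- Deciding equations between concrete polynomials

without : Mono → Poly → Poly
without e = filter (λ t → ¬? (Vec.≡-dec ℕ._≟_ (proj₂ t) e))

coeff-without : ∀ e μ p → e ≢ μ → coeff (without e p) μ ≡ coeff p μ
coeff-without e μ []            e≢μ = refl
coeff-without e μ ((c , f) ∷ p) e≢μ with Vec.≡-dec ℕ._≟_ f e
... | yes refl = begin
  coeff (without f p) μ       ≡⟨ coeff-without f μ p e≢μ ⟩
  coeff p μ                   ≡⟨ ℚ[i].+-identityˡ (coeff p μ) ⟨
  0i ⊕ coeff p μ              ≡⟨ cong (_⊕ coeff p μ) (coeffᵗ-≢ f μ c e≢μ) ⟨
  coeffᵗ (c , f) μ ⊕ coeff p μ ≡⟨ coeff-∷ (c , f) p μ ⟨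
  coeff ((c , f) ∷ p) μ       ∎
  where open ≡-Reasoning
... | no _ = trans (coeff-∷ (c , f) (without e p) μ)
                   (trans (cong (coeffᵗ (c , f) μ ⊕_) (coeff-without e μ p e≢μ)) (sym (coeff-∷ (c , f) p μ)))

-- the length of p is fuel: each step discards at least the leading term
isZeroᵇ : ℕ → Poly → Bool
isZeroᵇ _       []            = true
isZeroᵇ zero    (_ ∷ _)       = false
isZeroᵇ (suc n) ((c , e) ∷ p) = ⌊ coeff ((c , e) ∷ p) e ≟ℚi 0i ⌋ ∧ isZeroᵇ n (without e p)

isZeroᵇ-sound : ∀ n p → T (isZeroᵇ n p) → p ≈ 0P
isZeroᵇ-sound _       []            _  = ≈-refl
isZeroᵇ-sound (suc n) ((c , e) ∷ p) ok = mk≈ λ μ → vanishes μ (Vec.≡-dec ℕ._≟_ e μ)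
  where
  both : T ⌊ coeff ((c , e) ∷ p) e ≟ℚi 0i ⌋ × T (isZeroᵇ n (without e p))
  both = Equivalence.to T-∧ ok
  lead≡0 : coeff ((c , e) ∷ p) e ≡ 0i
  lead≡0 = toWitness {a? = coeff ((c , e) ∷ p) e ≟ℚi 0i} (proj₁ both)
  rest≈0 : without e p ≈ 0P
  rest≈0 = isZeroᵇ-sound n (without e p) (proj₂ both)
  vanishes : ∀ μ → Dec (e ≡ μ) → coeff ((c , e) ∷ p) μ ≡ 0i
  vanishes μ (yes refl) = lead≡0
  vanishes μ (no e≢μ)   = begin
    coeff ((c , e) ∷ p) μ        ≡⟨ coeff-∷ (c , e) p μ ⟩
    coeffᵗ (c , e) μ ⊕ coeff p μ ≡⟨ cong₂ _⊕_ (coeffᵗ-≢ e μ c e≢μ) (sym (coeff-without e μ p e≢μ)) ⟩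
    0i ⊕ coeff (without e p) μ   ≡⟨ cong (0i ⊕_) (coeff-≡ rest≈0 μ) ⟩
    0i ⊕ 0i                      ≡⟨ ℚ[i].+-identityˡ 0i ⟩
    0i                           ∎
    where open ≡-Reasoning

infix 4 _≈ᵇ_
_≈ᵇ_ : Poly → Poly → Bool
p ≈ᵇ q = isZeroᵇ (length (p -P q)) (p -P q)

≈ᵇ-sound : ∀ p q → T (p ≈ᵇ q) → p ≈ q
≈ᵇ-sound p q ok = begin
  p                ≈⟨ +-identityʳ p ⟨
  p +P 0P          ≈⟨ +-cong ≈-refl (-‿inverseˡ q) ⟨
  p +P (-P q +P q) ≈⟨ +-assoc p (-P q) q ⟨
  (p -P q) +P q    ≈⟨ +-cong (isZeroᵇ-sound _ (p -P q) ok) ≈-refl ⟩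
  q                ∎
  where open SetoidReasoning ≈-setoid

✓ : ∀ {p q} {_ : T (p ≈ᵇ q)} → p ≈ q
✓ {p} {q} {ok} = ≈ᵇ-sound p q ok

cases : {P : Fin 4 → Set} → P zero → P (suc zero) → P (suc (suc zero)) → P (suc (suc (suc zero))) → ∀ i → P i
cases p₀ p₁ p₂ p₃ zero                   = p₀
cases p₀ p₁ p₂ p₃ (suc zero)             = p₁
cases p₀ p₁ p₂ p₃ (suc (suc zero))       = p₂
cases p₀ p₁ p₂ p₃ (suc (suc (suc zero))) = p₃

-- The common shape of the vectors

w⟨_,_⟩ : ℕ → ℕ → Poly → Poly
w⟨ a , b ⟩ x = ξsq ^P a *P (x *P ξ24 ^P b)

record Kills (d : Var → Poly) : Set where
  field
    kills-ξsq : derivP d ξsq ≈ 0P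
    kills-ξ24 : derivP d ξ24 ≈ 0P

record Scales (s : Var → Poly) (σ : ℚi) : Set where
  field
    fixes-ξsq  : substP s ξsq ≈ ξsq
    scales-ξ24 : substP s ξ24 ≈ σ ·P ξ24

module _ (a b : ℕ) where

  w-cong : ∀ {x y} → x ≈ y → w⟨ a , b ⟩ x ≈ w⟨ a , b ⟩ y
  w-cong x≈y = *-congˡ (ξsq ^P a) (*-congʳ (ξ24 ^P b) x≈y)

  w-isLinear : IsLinear w⟨ a , b ⟩
  w-isLinear = record
    { +-homo = λ x y → ≈-trans (*-congˡ (ξsq ^P a) (*-distribʳ (ξ24 ^P b) x y)) (Poly.distribˡ (ξsq ^P a) _ _)
    ; ·-homo = λ c x → ≈-trans (*-congˡ (ξsq ^P a) (·-*ˡ c x (ξ24 ^P b))) (·-*ʳ c (ξsq ^P a) _)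
    }

  derivP-w : ∀ d → Kills d → ∀ x → derivP d (w⟨ a , b ⟩ x) ≈ w⟨ a , b ⟩ (derivP d x)
  derivP-w d kills x = begin
    derivP d (ξsq ^P a *P (x *P ξ24 ^P b))
      ≈⟨ derivP-* d (ξsq ^P a) (x *P ξ24 ^P b) ⟩
    derivP d (ξsq ^P a) *P (x *P ξ24 ^P b) +P ξsq ^P a *P derivP d (x *P ξ24 ^P b)
      ≈⟨ +-cong (*-congʳ (x *P ξ24 ^P b) (derivP-^ d a kills-ξsq)) (*-congˡ (ξsq ^P a) (derivP-* d x (ξ24 ^P b))) ⟩
    0P *P (x *P ξ24 ^P b) +P ξsq ^P a *P (derivP d x *P ξ24 ^P b +P x *P derivP d (ξ24 ^P b))
      ≈⟨ +-cong (Poly.zeroˡ (x *P ξ24 ^P b)) (*-congˡ (ξsq ^P a) (+-cong ≈-refl (*-congˡ x (derivP-^ d b kills-ξ24)))) ⟩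
    0P +P ξsq ^P a *P (derivP d x *P ξ24 ^P b +P x *P 0P)
      ≈⟨ *-congˡ (ξsq ^P a) (≈-trans (+-cong ≈-refl (Poly.zeroʳ x)) (+-identityʳ _)) ⟩
    w⟨ a , b ⟩ (derivP d x) ∎
    where
    open SetoidReasoning ≈-setoid
    open Kills kills

  substP-w : ∀ s σ → Scales s σ → ∀ x → substP s (w⟨ a , b ⟩ x) ≈ (σ ^ b) ·P w⟨ a , b ⟩ (substP s x)
  substP-w s σ scales x = begin
    substP s (ξsq ^P a *P (x *P ξ24 ^P b))
      ≈⟨ ≈-trans (substP-* s (ξsq ^P a) _) (*-congˡ (substP s (ξsq ^P a)) (substP-* s x (ξ24 ^P b))) ⟩
    substP s (ξsq ^P a) *P (substP s x *P substP s (ξ24 ^P b))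
      ≈⟨ *-cong (≈-trans (substP-^ s ξsq a) (^P-cong a fixes-ξsq))
                (*-congˡ (substP s x) (≈-trans (substP-^ s ξ24 b) (≈-trans (^P-cong b scales-ξ24) (·-^P σ ξ24 b)))) ⟩
    ξsq ^P a *P (substP s x *P ((σ ^ b) ·P ξ24 ^P b))
      ≈⟨ ≈-trans (*-congˡ (ξsq ^P a) (·-*ʳ (σ ^ b) (substP s x) (ξ24 ^P b))) (·-*ʳ (σ ^ b) (ξsq ^P a) _) ⟩
    (σ ^ b) ·P w⟨ a , b ⟩ (substP s x) ∎
    where
    open SetoidReasoning ≈-setoid
    open Scales scales

-- Parities and signs

even-or-odd : ∀ n → 2 ∣ n ⊎ 2 ∣ suc n
even-or-odd zero    = inj₁ (2 ∣0)
even-or-odd (suc n) with even-or-odd n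
... | inj₁ 2∣n   = inj₂ (∣m∣n⇒∣m+n ∣-refl 2∣n)
... | inj₂ 2∣1+n = inj₁ 2∣1+n

odd⇒even-pred : ∀ {n} → 2 ∤ n → 2 ∣ n ∸ 1
odd⇒even-pred {zero}  2∤0   = ⊥-elim (2∤0 (2 ∣0))
odd⇒even-pred {suc n} 2∤1+n with even-or-odd n
... | inj₁ 2∣n   = 2∣n
... | inj₂ 2∣1+n = ⊥-elim (2∤1+n 2∣1+n)

^-even : ∀ {σ} → σ ⊛ σ ≡ 1i → ∀ {n} → 2 ∣ n → σ ^ n ≡ 1i
^-even {σ} σ²≡1 (divides q refl) = σ^[2q]≡1 q
  where
  σ^[2q]≡1 : ∀ q → σ ^ (q * 2) ≡ 1i
  σ^[2q]≡1 zero    = refl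
  σ^[2q]≡1 (suc q) = begin
    σ ⊛ (σ ⊛ σ ^ (q * 2)) ≡⟨ ℚ[i].*-assoc σ σ (σ ^ (q * 2)) ⟨
    (σ ⊛ σ) ⊛ σ ^ (q * 2) ≡⟨ cong₂ _⊛_ σ²≡1 (σ^[2q]≡1 q) ⟩
    1i ⊛ 1i               ≡⟨ ℚ[i].*-identityˡ 1i ⟩
    1i                    ∎
    where open ≡-Reasoning

1^n≡1 : ∀ n → 1i ^ n ≡ 1i
1^n≡1 zero    = refl
1^n≡1 (suc n) = trans (ℚ[i].*-identityˡ (1i ^ n)) (1^n≡1 n)

sgn≡-1^ : ∀ n → sgn n ≡ (⊝ 1i) ^ n
sgn≡-1^ zero    = refl
sgn≡-1^ (suc n) = trans (cong ⊝_ (sgn≡-1^ n)) (sym (-1*x≈-x ((⊝ 1i) ^ n)))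
  where open RingProperties ℚ[i].ring using (-1*x≈-x)

sgn-+ : ∀ m n → sgn (m + n) ≡ sgn m ⊛ sgn n
sgn-+ m n = trans (sgn≡-1^ (m + n)) (trans (^-homo-* (⊝ 1i) m n) (sym (cong₂ _⊛_ (sgn≡-1^ m) (sgn≡-1^ n))))
  where open SemiringExp ℚ[i].semiring using (^-homo-*)

sgn-odd : ∀ {n} → 2 ∤ n → sgn n ≡ ⊝ 1i
sgn-odd {zero}  2∤0 = ⊥-elim (2∤0 (2 ∣0))
sgn-odd {suc n} 2∤n = cong ⊝_ (trans (sgn≡-1^ n) (^-even refl (odd⇒even-pred 2∤n)))

sgn-odd-difference : ∀ {m n} → n ≤ m → 2 ∤ m ∸ n → sgn n ⊛ (⊝ 1i) ≡ sgn m
sgn-odd-difference {m} {n} n≤m 2∤m-n = begin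
  sgn n ⊛ (⊝ 1i)       ≡⟨ cong (sgn n ⊛_) (sgn-odd 2∤m-n) ⟨
  sgn n ⊛ sgn (m ∸ n)  ≡⟨ sgn-+ n (m ∸ n) ⟨
  sgn (n + (m ∸ n))    ≡⟨ cong sgn (ℕ.m+[n∸m]≡n n≤m) ⟩
  sgn m                ∎
  where open ≡-Reasoning

-- The actions of E₁₃, E₂₄ and the m_i

sign₂₄ : Fin 4 → ℚi
sign₂₄ x = m x 𝟚 𝟚 ⊛ m x 𝟜 𝟜

sign₂₄²≡1 : ∀ x → sign₂₄ x ⊛ sign₂₄ x ≡ 1i
sign₂₄²≡1 = cases refl refl refl refl

E₁₃-kills : Kills (lieVar (Eᵏ 𝟙 𝟛))
E₁₃-kills = record { kills-ξsq = ✓ ; kills-ξ24 = ✓ }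

E₂₄-kills : Kills (lieVar (Eᵏ 𝟚 𝟜))
E₂₄-kills = record { kills-ξsq = ✓ ; kills-ξ24 = ✓ }

m-scales : ∀ x → Scales (grpVar (m x)) (sign₂₄ x)
m-scales = cases (record { fixes-ξsq = ✓ ; scales-ξ24 = ✓ }) (record { fixes-ξsq = ✓ ; scales-ξ24 = ✓ })
                 (record { fixes-ξsq = ✓ ; scales-ξ24 = ✓ }) (record { fixes-ξsq = ✓ ; scales-ξ24 = ✓ })

-- Part (a)

module _ (a b : ℕ) where

  derivP-ξsq^a*ξ24^b : ∀ d → Kills d → derivP d (ξsq ^P a *P ξ24 ^P b) ≈ 0P
  derivP-ξsq^a*ξ24^b d kills = begin
    derivP d (ξsq ^P a *P ξ24 ^P b)                                   ≈⟨ derivP-* d (ξsq ^P a) (ξ24 ^P b) ⟩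
    derivP d (ξsq ^P a) *P ξ24 ^P b +P ξsq ^P a *P derivP d (ξ24 ^P b) ≈⟨ +-cong (*-congʳ (ξ24 ^P b) (derivP-^ d a kills-ξsq))
                                                                                  (*-congˡ (ξsq ^P a) (derivP-^ d b kills-ξ24)) ⟩
    0P *P ξ24 ^P b +P ξsq ^P a *P 0P                                  ≈⟨ +-cong (Poly.zeroˡ (ξ24 ^P b)) (Poly.zeroʳ (ξsq ^P a)) ⟩
    0P                                                                ∎
    where
    open SetoidReasoning ≈-setoid
    open Kills kills

  substP-ξsq^a*ξ24^b : ∀ s σ → Scales s σ → substP s (ξsq ^P a *P ξ24 ^P b) ≈ (σ ^ b) ·P (ξsq ^P a *P ξ24 ^P b)
  substP-ξsq^a*ξ24^b s σ scales = begin
    substP s (ξsq ^P a *P ξ24 ^P b)               ≈⟨ substP-* s (ξsq ^P a) (ξ24 ^P b) ⟩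
    substP s (ξsq ^P a) *P substP s (ξ24 ^P b)    ≈⟨ *-cong (≈-trans (substP-^ s ξsq a) (^P-cong a fixes-ξsq))
                                                            (≈-trans (substP-^ s ξ24 b) (≈-trans (^P-cong b scales-ξ24) (·-^P σ ξ24 b))) ⟩
    ξsq ^P a *P ((σ ^ b) ·P ξ24 ^P b)             ≈⟨ ·-*ʳ (σ ^ b) (ξsq ^P a) (ξ24 ^P b) ⟩
    (σ ^ b) ·P (ξsq ^P a *P ξ24 ^P b)             ∎
    where
    open SetoidReasoning ≈-setoid
    open Scales scales

part-a : ∀ κ₁ κ₂ → 2 ∣ κ₂ →
           (τ𝔨 (Eᵏ 𝟙 𝟛) (w₀ κ₁ κ₂) ≈V 0P)
         × (τ𝔨 (Eᵏ 𝟚 𝟜) (w₀ κ₁ κ₂) ≈V 0P)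
         × ((i : Fin 4) → τK (m i) (w₀ κ₁ κ₂) ≈V w₀ κ₁ κ₂)
part-a κ₁ κ₂ 2∣κ₂ = ≈⇒≈V (derivP-ξsq^a*ξ24^b a κ₂ (lieVar (Eᵏ 𝟙 𝟛)) E₁₃-kills)
                  , ≈⇒≈V (derivP-ξsq^a*ξ24^b a κ₂ (lieVar (Eᵏ 𝟚 𝟜)) E₂₄-kills)
                  , λ i → ≈⇒≈V (≈-trans (substP-ξsq^a*ξ24^b a κ₂ (grpVar (m i)) (sign₂₄ i) (m-scales i))
                                        (·-identity′ (^-even (sign₂₄²≡1 i) 2∣κ₂) (w₀ κ₁ κ₂)))
  where a = (κ₁ ∸ κ₂) / 2

-- Part (b)

wB-shape : (Fin 4 → Fin 4 → Poly) → PMat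
wB-shape y = Eᵖ⊗ 𝟙 𝟚 (y 𝟙 𝟚) +PM (-PM Eᵖ⊗ 𝟚 𝟛 (y 𝟚 𝟛)) +PM Eᵖ⊗ 𝟛 𝟜 (y 𝟛 𝟜) +PM Eᵖ⊗ 𝟙 𝟜 (y 𝟙 𝟜)

private
  Eᵖ : Fin 4 → Fin 4 → Fin 4 → Fin 4 → ℚi
  Eᵖ a b i j = E a b i j ⊕ E b a i j

wB-shape-cong : ∀ {y y′} → (∀ p q → y p q ≈ y′ p q) → ∀ i j → wB-shape y i j ≈ wB-shape y′ i j
wB-shape-cong y≈y′ i j =
  +-cong (+-cong (+-cong (·-cong (Eᵖ 𝟙 𝟚 i j) (y≈y′ 𝟙 𝟚)) (·-cong (⊝ 1i) (·-cong (Eᵖ 𝟚 𝟛 i j) (y≈y′ 𝟚 𝟛))))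
                 (·-cong (Eᵖ 𝟛 𝟜 i j) (y≈y′ 𝟛 𝟜)))
         (·-cong (Eᵖ 𝟙 𝟜 i j) (y≈y′ 𝟙 𝟜))

wB-shape-linear : ∀ {L} → IsLinear L → ∀ y i j → L (wB-shape y i j) ≈ wB-shape (λ p q → L (y p q)) i j
wB-shape-linear {L} lin y i j =
  ≈-trans (+-homo (y₁₂ +P -P y₂₃ +P y₃₄) y₁₄)
    (+-cong (≈-trans (+-homo (y₁₂ +P -P y₂₃) y₃₄)
              (+-cong (≈-trans (+-homo y₁₂ (-P y₂₃))
                        (+-cong (·-homo (Eᵖ 𝟙 𝟚 i j) (y 𝟙 𝟚))
                                (≈-trans (·-homo (⊝ 1i) y₂₃) (·-cong (⊝ 1i) (·-homo (Eᵖ 𝟚 𝟛 i j) (y 𝟚 𝟛))))))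
                      (·-homo (Eᵖ 𝟛 𝟜 i j) (y 𝟛 𝟜))))
            (·-homo (Eᵖ 𝟙 𝟜 i j) (y 𝟙 𝟜)))
  where
  open IsLinear lin
  y₁₂ = Eᵖ 𝟙 𝟚 i j ·P y 𝟙 𝟚
  y₂₃ = Eᵖ 𝟚 𝟛 i j ·P y 𝟚 𝟛
  y₃₄ = Eᵖ 𝟛 𝟜 i j ·P y 𝟛 𝟜
  y₁₄ = Eᵖ 𝟙 𝟜 i j ·P y 𝟙 𝟜

adτ-cong : ∀ X {W W′ : PMat} → (∀ i j → W i j ≈ W′ i j) → ∀ i j → adτ X W i j ≈ adτ X W′ i j
adτ-cong X W≈W′ i j =
  +-cong (sumF-cong (λ l → +-cong (·-cong (X i l) (W≈W′ l j)) (·-cong (⊝ 1i) (·-cong (X l j) (W≈W′ i l)))))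
         (derivP-cong (lieVar X) (W≈W′ i j))

module _ (a b : ℕ) where

  adτ-w : ∀ X → Kills (lieVar X) → ∀ W i j → adτ X (λ i j → w⟨ a , b ⟩ (W i j)) i j ≈ w⟨ a , b ⟩ (adτ X W i j)
  adτ-w X kills W i j = ≈-sym (≈-trans (+-homo (sumF bracket) (τ𝔨 X (W i j))) (+-cong
    (≈-trans (sumF-homo bracket) (sumF-cong λ l →
      ≈-trans (+-homo (X i l ·P W l j) (-P (X l j ·P W i l)))
              (+-cong (·-homo (X i l) (W l j))
                      (≈-trans (·-homo (⊝ 1i) (X l j ·P W i l)) (·-cong (⊝ 1i) (·-homo (X l j) (W i l)))))))
    (≈-sym (derivP-w a b (lieVar X) kills (W i j)))))
    where
    open IsLinear (w-isLinear a b)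
    bracket : Fin 4 → Poly
    bracket l = X i l ·P W l j -P X l j ·P W i l

  substP-wB-shape : ∀ s σ → Scales s σ → σ ^ b ≡ 1i → ∀ y i j →
                    substP s (wB-shape (λ p q → w⟨ a , b ⟩ (y p q)) i j) ≈ w⟨ a , b ⟩ (substP s (wB-shape y i j))
  substP-wB-shape s σ scales σᵇ≡1 y i j = begin
    substP s (wB-shape (λ p q → w⟨ a , b ⟩ (y p q)) i j) ≈⟨ wB-shape-linear (substP-isLinear s) (λ p q → w⟨ a , b ⟩ (y p q)) i j ⟩
    wB-shape (λ p q → substP s (w⟨ a , b ⟩ (y p q))) i j ≈⟨ wB-shape-cong (λ p q → ≈-trans (substP-w a b s σ scales (y p q))
                                                                                    (·-identity′ σᵇ≡1 (w⟨ a , b ⟩ (substP s (y p q))))) i j ⟩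
    wB-shape (λ p q → w⟨ a , b ⟩ (substP s (y p q))) i j ≈⟨ wB-shape-linear (w-isLinear a b) (λ p q → substP s (y p q)) i j ⟨
    w⟨ a , b ⟩ (wB-shape (λ p q → substP s (y p q)) i j) ≈⟨ w-cong a b (wB-shape-linear (substP-isLinear s) y i j) ⟨
    w⟨ a , b ⟩ (substP s (wB-shape y i j))               ∎
    where open SetoidReasoning ≈-setoid

IsDiagonal : Mat → Set
IsDiagonal k = ∀ a b → a ≢ b → k a b ≡ 0i

diag-isDiagonal : ∀ d → IsDiagonal (diag d)
diag-isDiagonal d a b a≢b with a Fin.≟ b
... | yes a≡b = ⊥-elim (a≢b a≡b)
... | no _    = ℚ[i].zeroˡ (d a)

sumF-single : ∀ {n} (f : Fin n → Poly) i → (∀ l → l ≢ i → f l ≈ 0P) → sumF f ≈ f i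
sumF-single f zero    f≈0 = ≈-trans (+-cong ≈-refl (sumF-zero (λ l → f≈0 (suc l) λ ()))) (+-identityʳ (f zero))
sumF-single f (suc i) f≈0 = ≈-trans (+-cong (f≈0 zero λ ()) ≈-refl)
                                    (sumF-single (λ l → f (suc l)) i (λ l l≢i → f≈0 (suc l) (l≢i ∘ Fin.suc-injective)))

Adτ-diagonal : ∀ {k} → IsDiagonal k → ∀ W i j → Adτ k W i j ≈ (k i i ⊛ k j j) ·P substP (grpVar k) (W i j)
Adτ-diagonal {k} diagonal W i j =
  ≈-trans (sumF-single (λ a → sumF λ b → (k i a ⊛ k j b) ·P τK k (W a b)) i λ a a≢i → sumF-zero λ b →
             ·-zero′ (trans (cong (_⊛ k j b) (diagonal i a (a≢i ∘ sym))) (ℚ[i].zeroˡ (k j b))) (τK k (W a b)))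
          (sumF-single (λ b → (k i i ⊛ k j b) ·P τK k (W i b)) j λ b b≢j →
             ·-zero′ (trans (cong (k i i ⊛_) (diagonal j b (b≢j ∘ sym))) (ℚ[i].zeroʳ (k i i))) (τK k (W i b)))

m-isDiagonal : ∀ x → IsDiagonal (m x)
m-isDiagonal = cases (diag-isDiagonal _) (diag-isDiagonal _) (diag-isDiagonal _) (diag-isDiagonal _)

E₁₃-kills-wB-shape-ξ₂ : ∀ i j → adτ (Eᵏ 𝟙 𝟛) (wB-shape ξ₂) i j ≈ 0P
E₁₃-kills-wB-shape-ξ₂ = cases (cases ✓ ✓ ✓ ✓) (cases ✓ ✓ ✓ ✓) (cases ✓ ✓ ✓ ✓) (cases ✓ ✓ ✓ ✓)

E₂₄-kills-wB-shape-ξ₂ : ∀ i j → adτ (Eᵏ 𝟚 𝟜) (wB-shape ξ₂) i j ≈ 0P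
E₂₄-kills-wB-shape-ξ₂ = cases (cases ✓ ✓ ✓ ✓) (cases ✓ ✓ ✓ ✓) (cases ✓ ✓ ✓ ✓) (cases ✓ ✓ ✓ ✓)

m-fixes-wB-shape-ξ₂ : ∀ x i j → (m x i i ⊛ m x j j) ·P substP (grpVar (m x)) (wB-shape ξ₂ i j) ≈ wB-shape ξ₂ i j
m-fixes-wB-shape-ξ₂ = cases
  (cases (cases ✓ ✓ ✓ ✓) (cases ✓ ✓ ✓ ✓) (cases ✓ ✓ ✓ ✓) (cases ✓ ✓ ✓ ✓))
  (cases (cases ✓ ✓ ✓ ✓) (cases ✓ ✓ ✓ ✓) (cases ✓ ✓ ✓ ✓) (cases ✓ ✓ ✓ ✓))
  (cases (cases ✓ ✓ ✓ ✓) (cases ✓ ✓ ✓ ✓) (cases ✓ ✓ ✓ ✓) (cases ✓ ✓ ✓ ✓))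
  (cases (cases ✓ ✓ ✓ ✓) (cases ✓ ✓ ✓ ✓) (cases ✓ ✓ ✓ ✓) (cases ✓ ✓ ✓ ✓))

part-b : ∀ κ₁ κ₂ → 2 ∤ κ₂ →
           (adτ (Eᵏ 𝟙 𝟛) (wB κ₁ κ₂) ≈PV 0PM)
         × (adτ (Eᵏ 𝟚 𝟜) (wB κ₁ κ₂) ≈PV 0PM)
         × ((i : Fin 4) → Adτ (m i) (wB κ₁ κ₂) ≈PV wB κ₁ κ₂)
part-b κ₁ κ₂ 2∤κ₂ = (λ i j → ≈⇒≈V (killed E₁₃-kills E₁₃-kills-wB-shape-ξ₂ i j))
                  , (λ i j → ≈⇒≈V (killed E₂₄-kills E₂₄-kills-wB-shape-ξ₂ i j))
                  , (λ x i j → ≈⇒≈V (fixed x i j))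
  where
  a = (κ₁ ∸ κ₂) / 2
  b = κ₂ ∸ 1
  wB≈w-wB-shape-ξ₂ : ∀ i j → wB κ₁ κ₂ i j ≈ w⟨ a , b ⟩ (wB-shape ξ₂ i j)
  wB≈w-wB-shape-ξ₂ = ≈-sym ∘₂ wB-shape-linear (w-isLinear a b) ξ₂
  killed : ∀ {X} → Kills (lieVar X) → (∀ i j → adτ X (wB-shape ξ₂) i j ≈ 0P) → ∀ i j → adτ X (wB κ₁ κ₂) i j ≈ 0P
  killed {X} kills core-killed i j = begin
    adτ X (wB κ₁ κ₂) i j                             ≈⟨ adτ-cong X wB≈w-wB-shape-ξ₂ i j ⟩
    adτ X (λ i j → w⟨ a , b ⟩ (wB-shape ξ₂ i j)) i j ≈⟨ adτ-w a b X kills (wB-shape ξ₂) i j ⟩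
    w⟨ a , b ⟩ (adτ X (wB-shape ξ₂) i j)             ≈⟨ w-cong a b (core-killed i j) ⟩
    w⟨ a , b ⟩ 0P                                    ≈⟨ IsLinear.0-homo (w-isLinear a b) ⟩
    0P                                               ∎
    where open SetoidReasoning ≈-setoid
  fixed : ∀ x i j → Adτ (m x) (wB κ₁ κ₂) i j ≈ wB κ₁ κ₂ i j
  -- Every equation is stated so that it matches the next one syntactically (hence also the explicit
  -- implicit arguments): otherwise the type checker evaluates substP on the concrete wB-shape ξ₂ i j.
  fixed x i j = let mᵢⱼ = m x i i ⊛ m x j j; s = grpVar (m x) in begin
    Adτ (m x) (wB κ₁ κ₂) i j                       ≈⟨ Adτ-diagonal (m-isDiagonal x) (wB κ₁ κ₂) i j ⟩
    mᵢⱼ ·P substP s (wB κ₁ κ₂ i j)                 ≈⟨ ·-cong mᵢⱼ (substP-wB-shape a b s (sign₂₄ x) (m-scales x) signᵇ≡1 ξ₂ i j) ⟩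
    mᵢⱼ ·P w⟨ a , b ⟩ (substP s (wB-shape ξ₂ i j)) ≈⟨ IsLinear.·-homo (w-isLinear a b) mᵢⱼ (substP s (wB-shape ξ₂ i j)) ⟨
    w⟨ a , b ⟩ (mᵢⱼ ·P substP s (wB-shape ξ₂ i j)) ≈⟨ w-cong a b {mᵢⱼ ·P substP s (wB-shape ξ₂ i j)} {wB-shape ξ₂ i j}
                                                               (m-fixes-wB-shape-ξ₂ x i j) ⟩
    w⟨ a , b ⟩ (wB-shape ξ₂ i j)                   ≈⟨ wB≈w-wB-shape-ξ₂ i j ⟨
    wB κ₁ κ₂ i j                                   ∎
    where
    open SetoidReasoning ≈-setoid
    signᵇ≡1 = ^-even (sign₂₄²≡1 x) (odd⇒even-pred 2∤κ₂)

-- Part (c)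

wC-core wCbar-core : Poly
wC-core    = ξ 𝟚 +P √-1 ·P ξ 𝟜
wCbar-core = ξ 𝟚 -P √-1 ·P ξ 𝟜

module _ (a b : ℕ) where

  private
    lin = w-isLinear a b

  wC≈w : ∀ x y → w⟨ a , b ⟩ x +P √-1 ·P w⟨ a , b ⟩ y ≈ w⟨ a , b ⟩ (x +P √-1 ·P y)
  wC≈w x y = ≈-sym (≈-trans (IsLinear.+-homo lin x (√-1 ·P y)) (+-cong ≈-refl (IsLinear.·-homo lin √-1 y)))

  wCbar≈w : ∀ x y → w⟨ a , b ⟩ x -P √-1 ·P w⟨ a , b ⟩ y ≈ w⟨ a , b ⟩ (x -P √-1 ·P y)
  wCbar≈w x y = ≈-sym (≈-trans (IsLinear.+-homo lin x (-P (√-1 ·P y)))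
                       (+-cong ≈-refl (≈-trans (IsLinear.·-homo lin (⊝ 1i) (√-1 ·P y)) (·-cong (⊝ 1i) (IsLinear.·-homo lin √-1 y)))))

  derivP-wC : ∀ d → Kills d → ∀ c → derivP d wC-core ≈ c ·P wC-core →
              derivP d (w⟨ a , b ⟩ (ξ 𝟚) +P √-1 ·P w⟨ a , b ⟩ (ξ 𝟜)) ≈ c ·P (w⟨ a , b ⟩ (ξ 𝟚) +P √-1 ·P w⟨ a , b ⟩ (ξ 𝟜))
  derivP-wC d kills c eigen = begin
    derivP d (w⟨ a , b ⟩ (ξ 𝟚) +P √-1 ·P w⟨ a , b ⟩ (ξ 𝟜)) ≈⟨ derivP-cong d (wC≈w (ξ 𝟚) (ξ 𝟜)) ⟩
    derivP d (w⟨ a , b ⟩ wC-core)                          ≈⟨ derivP-w a b d kills wC-core ⟩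
    w⟨ a , b ⟩ (derivP d wC-core)                          ≈⟨ w-cong a b eigen ⟩
    w⟨ a , b ⟩ (c ·P wC-core)                              ≈⟨ IsLinear.·-homo lin c wC-core ⟩
    c ·P w⟨ a , b ⟩ wC-core                                ≈⟨ ·-cong c (wC≈w (ξ 𝟚) (ξ 𝟜)) ⟨
    c ·P (w⟨ a , b ⟩ (ξ 𝟚) +P √-1 ·P w⟨ a , b ⟩ (ξ 𝟜))     ∎
    where open SetoidReasoning ≈-setoid

  substP-wC : ∀ s σ → Scales s σ →
              substP s (w⟨ a , b ⟩ (ξ 𝟚) +P √-1 ·P w⟨ a , b ⟩ (ξ 𝟜)) ≈ (σ ^ b) ·P w⟨ a , b ⟩ (substP s wC-core)
  substP-wC s σ scales = begin
    substP s (w⟨ a , b ⟩ (ξ 𝟚) +P √-1 ·P w⟨ a , b ⟩ (ξ 𝟜))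
      ≈⟨ ≈-trans (substP-+ s (w⟨ a , b ⟩ (ξ 𝟚)) (√-1 ·P w⟨ a , b ⟩ (ξ 𝟜))) (+-cong ≈-refl (substP-· s √-1 (w⟨ a , b ⟩ (ξ 𝟜)))) ⟩
    substP s (w⟨ a , b ⟩ (ξ 𝟚)) +P √-1 ·P substP s (w⟨ a , b ⟩ (ξ 𝟜))
      ≈⟨ +-cong (substP-w a b s σ scales (ξ 𝟚)) (·-cong √-1 (substP-w a b s σ scales (ξ 𝟜))) ⟩
    (σ ^ b) ·P w⟨ a , b ⟩ (substP s (ξ 𝟚)) +P √-1 ·P ((σ ^ b) ·P w⟨ a , b ⟩ (substP s (ξ 𝟜)))
      ≈⟨ +-cong ≈-refl (·-comm √-1 (σ ^ b) (w⟨ a , b ⟩ (substP s (ξ 𝟜)))) ⟩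
    (σ ^ b) ·P w⟨ a , b ⟩ (substP s (ξ 𝟚)) +P (σ ^ b) ·P (√-1 ·P w⟨ a , b ⟩ (substP s (ξ 𝟜)))
      ≈⟨ ·-distribˡ (σ ^ b) (w⟨ a , b ⟩ (substP s (ξ 𝟚))) (√-1 ·P w⟨ a , b ⟩ (substP s (ξ 𝟜))) ⟨
    (σ ^ b) ·P (w⟨ a , b ⟩ (substP s (ξ 𝟚)) +P √-1 ·P w⟨ a , b ⟩ (substP s (ξ 𝟜)))
      ≈⟨ ·-cong (σ ^ b) (wC≈w (substP s (ξ 𝟚)) (substP s (ξ 𝟜))) ⟩
    (σ ^ b) ·P w⟨ a , b ⟩ (substP s (ξ 𝟚) +P √-1 ·P substP s (ξ 𝟜))
      ≈⟨ ·-cong (σ ^ b) (w-cong a b {substP s wC-core} {substP s (ξ 𝟚) +P √-1 ·P substP s (ξ 𝟜)}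
                                   (≈-trans (substP-+ s (ξ 𝟚) (√-1 ·P ξ 𝟜)) (+-cong ≈-refl (substP-· s √-1 (ξ 𝟜))))) ⟨
    (σ ^ b) ·P w⟨ a , b ⟩ (substP s wC-core)
      ∎
    where open SetoidReasoning ≈-setoid

part-c : ∀ κ₁ κ₂ → κ₂ ≤ κ₁ → 2 ∤ (κ₁ ∸ κ₂) →
           (τ𝔨 (Eᵏ 𝟙 𝟛) (wC κ₁ κ₂) ≈V 0P)
         × (τ𝔨 (Eᵏ 𝟚 𝟜) (wC κ₁ κ₂) ≈V (√-1 ·P wC κ₁ κ₂))
         × (τK (m zero) (wC κ₁ κ₂) ≈V wC κ₁ κ₂)
         × (τK (m (suc zero)) (wC κ₁ κ₂) ≈V wC κ₁ κ₂)
         × (τK (m (suc (suc zero))) (wC κ₁ κ₂) ≈V (sgn κ₁ ·P wCbar κ₁ κ₂))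
         × (τK (m (suc (suc (suc zero)))) (wC κ₁ κ₂) ≈V (sgn κ₁ ·P wCbar κ₁ κ₂))
part-c κ₁ κ₂ κ₂≤κ₁ 2∤κ₁-κ₂ =
    ≈⇒≈V (≈-trans (derivP-wC a κ₂ (lieVar (Eᵏ 𝟙 𝟛)) E₁₃-kills 0i ✓) (·-zeroˡ (wC κ₁ κ₂)))
  , ≈⇒≈V (derivP-wC a κ₂ (lieVar (Eᵏ 𝟚 𝟜)) E₂₄-kills √-1 ✓)
  , ≈⇒≈V (fixed zero refl ✓)
  , ≈⇒≈V (fixed (suc zero) refl ✓)
  , ≈⇒≈V (conjugated (suc (suc zero)) refl ✓)
  , ≈⇒≈V (conjugated (suc (suc (suc zero))) refl ✓)
  where
  a = (κ₁ ∸ κ₂ ∸ 1) / 2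
  acts : ∀ x c y → substP (grpVar (m x)) wC-core ≈ c ·P y →
         substP (grpVar (m x)) (wC κ₁ κ₂) ≈ (sign₂₄ x ^ κ₂ ⊛ c) ·P w⟨ a , κ₂ ⟩ y
  acts x c y m-wC-core = begin
    substP (grpVar (m x)) (wC κ₁ κ₂)                            ≈⟨ substP-wC a κ₂ (grpVar (m x)) (sign₂₄ x) (m-scales x) ⟩
    (sign₂₄ x ^ κ₂) ·P w⟨ a , κ₂ ⟩ (substP (grpVar (m x)) wC-core)   ≈⟨ ·-cong (sign₂₄ x ^ κ₂) (w-cong a κ₂ {substP (grpVar (m x)) wC-core} {c ·P y} m-wC-core) ⟩
    (sign₂₄ x ^ κ₂) ·P w⟨ a , κ₂ ⟩ (c ·P y)                          ≈⟨ ·-cong (sign₂₄ x ^ κ₂) (IsLinear.·-homo (w-isLinear a κ₂) c y) ⟩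
    (sign₂₄ x ^ κ₂) ·P (c ·P w⟨ a , κ₂ ⟩ y)                          ≈⟨ ·-assoc (sign₂₄ x ^ κ₂) c (w⟨ a , κ₂ ⟩ y) ⟩
    (sign₂₄ x ^ κ₂ ⊛ c) ·P w⟨ a , κ₂ ⟩ y                             ∎
    where open SetoidReasoning ≈-setoid
  fixed : ∀ x → sign₂₄ x ≡ 1i → substP (grpVar (m x)) wC-core ≈ 1i ·P wC-core → τK (m x) (wC κ₁ κ₂) ≈ wC κ₁ κ₂
  fixed x sign≡1 m-wC-core = begin
    substP (grpVar (m x)) (wC κ₁ κ₂)    ≈⟨ acts x 1i wC-core m-wC-core ⟩
    (sign₂₄ x ^ κ₂ ⊛ 1i) ·P w⟨ a , κ₂ ⟩ wC-core ≈⟨ ·-identity′ sign^κ₂≡1 (w⟨ a , κ₂ ⟩ wC-core) ⟩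
    w⟨ a , κ₂ ⟩ wC-core                 ≈⟨ wC≈w a κ₂ (ξ 𝟚) (ξ 𝟜) ⟨
    wC κ₁ κ₂                            ∎
    where
    open SetoidReasoning ≈-setoid
    sign^κ₂≡1 : sign₂₄ x ^ κ₂ ⊛ 1i ≡ 1i
    sign^κ₂≡1 = trans (ℚ[i].*-identityʳ (sign₂₄ x ^ κ₂)) (trans (cong (_^ κ₂) sign≡1) (1^n≡1 κ₂))
  conjugated : ∀ x → sign₂₄ x ≡ ⊝ 1i → substP (grpVar (m x)) wC-core ≈ (⊝ 1i) ·P wCbar-core →
               τK (m x) (wC κ₁ κ₂) ≈ sgn κ₁ ·P wCbar κ₁ κ₂
  conjugated x sign≡-1 m-wC-core = begin
    substP (grpVar (m x)) (wC κ₁ κ₂)              ≈⟨ acts x (⊝ 1i) wCbar-core m-wC-core ⟩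
    (sign₂₄ x ^ κ₂ ⊛ (⊝ 1i)) ·P w⟨ a , κ₂ ⟩ wCbar-core ≡⟨ cong (_·P w⟨ a , κ₂ ⟩ wCbar-core) sign ⟩
    sgn κ₁ ·P w⟨ a , κ₂ ⟩ wCbar-core              ≈⟨ ·-cong (sgn κ₁) (wCbar≈w a κ₂ (ξ 𝟚) (ξ 𝟜)) ⟨
    sgn κ₁ ·P wCbar κ₁ κ₂                         ∎
    where
    open SetoidReasoning ≈-setoid
    sign : sign₂₄ x ^ κ₂ ⊛ (⊝ 1i) ≡ sgn κ₁
    sign = trans (cong (λ s → s ^ κ₂ ⊛ (⊝ 1i)) sign≡-1)
                 (trans (cong (_⊛ (⊝ 1i)) (sym (sgn≡-1^ κ₂))) (sgn-odd-difference κ₂≤κ₁ 2∤κ₁-κ₂))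

lemma6p7 : (κ₁ κ₂ : ℕ) → 2 ≤ κ₂ → κ₂ ≤ κ₁ →
  ((2 ∣ κ₁ → 2 ∣ κ₂ →
      (τ𝔨 (Eᵏ 𝟙 𝟛) (w₀ κ₁ κ₂) ≈V 0P)
    × (τ𝔨 (Eᵏ 𝟚 𝟜) (w₀ κ₁ κ₂) ≈V 0P)
    × ((i : Fin 4) → τK (m i) (w₀ κ₁ κ₂) ≈V w₀ κ₁ κ₂))
  × (¬ (2 ∣ κ₁) → ¬ (2 ∣ κ₂) →
      (adτ (Eᵏ 𝟙 𝟛) (wB κ₁ κ₂) ≈PV 0PM)
    × (adτ (Eᵏ 𝟚 𝟜) (wB κ₁ κ₂) ≈PV 0PM)
    × ((i : Fin 4) → Adτ (m i) (wB κ₁ κ₂) ≈PV wB κ₁ κ₂))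
  × (¬ (2 ∣ (κ₁ ∸ κ₂)) →
      (τ𝔨 (Eᵏ 𝟙 𝟛) (wC κ₁ κ₂) ≈V 0P)
    × (τ𝔨 (Eᵏ 𝟚 𝟜) (wC κ₁ κ₂) ≈V (√-1 ·P wC κ₁ κ₂))
    × (τK (m zero) (wC κ₁ κ₂) ≈V wC κ₁ κ₂)
    × (τK (m (suc zero)) (wC κ₁ κ₂) ≈V wC κ₁ κ₂)
    × (τK (m (suc (suc zero))) (wC κ₁ κ₂) ≈V (sgn κ₁ ·P wCbar κ₁ κ₂))
    × (τK (m (suc (suc (suc zero)))) (wC κ₁ κ₂) ≈V (sgn κ₁ ·P wCbar κ₁ κ₂))))
lemma6p7 κ₁ κ₂ _ κ₂≤κ₁ =
    (λ _ 2∣κ₂ → part-a κ₁ κ₂ 2∣κ₂)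
  , (λ _ 2∤κ₂ → part-b κ₁ κ₂ 2∤κ₂)
  , part-c κ₁ κ₂ κ₂≤κ₁
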